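{- For $\omega_0=a\omega_0'\in\mathfrak{A}^0$ (with $\omega_0'\in\mathfrak{A}$) we have $$\mathrm{reg}^T_{\sqcup\!\sqcup}\Big((1-b_0u)^{ -1}\omega_0\Big)=\exp(-du)(\omega_0)\,e^{Tu}=a\Big((1+b_0u)^{ -1}\sqcup\!\sqcup\,\omega_0'\Big)e^{Tu}.$$
   Context: Fix $N\ge1$. $\mathfrak{A}=\mathbb{Q}\langle a,b_0,\dots,b_{N-1}\rangle$ (concatenation as juxtaposition, unit $\mathbf{1}=1$); $\mathfrak{A}^1$ = span of words not ending in $a$; $\mathfrak{A}^0$ = span of $\mathbf{1}$ and words neither beginning with $b_0$ nor ending with $a$. Shuffle: bilinear, $\mathbf{1}\sqcup\!\sqcup w=w\sqcup\!\sqcup\mathbf{1}=w$, $xu'\sqcup\!\sqcup yv=x(u'\sqcup\!\sqcup yv)+y(xu'\sqcup\!\sqcup v)$ for letters $x,y$. $d(w)=b_0\sqcup\!\sqcup w-b_0w$ (a derivation of $\mathfrak{A}$), $\exp(-du)=\sum_n(-u)^nd^n/n!$. $\mathrm{reg}^T_{\sqcup\!\sqcup}$ is the $\mathfrak{A}^0$-algebra isomorphism $(\mathfrak{A}^1,\sqcup\!\sqcup)=\mathfrak{A}^0[b_0]\to\mathfrak{A}^0[T]$ sending $b_0\mapsto T$, extended coefficientwise in the formal parameter $u$; $(1\mp b_0u)^{ -1}=\sum_n(\pm b_0u)^n$ (concatenation powers). -}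

module Defs where

open import Data.Nat as ℕ using (ℕ; zero; suc; _∸_)
open import Data.Integer using (+_)
open import Data.Fin using (Fin; zero; suc)
import Data.Fin.Properties as FinP
open import Data.List using (List; []; _∷_; _++_; map; concatMap; upTo)
open import Data.Product using (_×_; _,_)
open import Data.Bool using (if_then_else_)
open import Data.Unit using (⊤)
open import Data.Empty using (⊥)
open import Data.Rational using (ℚ; 0ℚ; 1ℚ; _+_; _*_; -_; _/_)
open import Relation.Nullary using (¬_; yes; no; Dec)
open import Relation.Nullary.Decidable using (⌊_⌋)
open import Relation.Binary.PropositionalEquality using (_≡_; _≢_; refl; cong)
import Data.List.Properties as ListP

-- Alphabet {a, b_0, ..., b_{N-1}} with N = suc M (so N ≥ 1).

data Letter (M : ℕ) : Set where
  a : Letter M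
  b : Fin (suc M) → Letter M

module _ {M : ℕ} where

  _≟L_ : (x y : Letter M) → Dec (x ≡ y)
  a ≟L a = yes refl
  a ≟L b j = no (λ ())
  b i ≟L a = no (λ ())
  b i ≟L b j with i FinP.≟ j
  ... | yes refl = yes refl
  ... | no ne = no (λ { refl → ne refl })

  Word : Set
  Word = List (Letter M)

  _≟W_ : (u v : Word) → Dec (u ≡ v)
  _≟W_ = ListP.≡-dec _≟L_

  -- 𝔄 = ℚ⟨a,b_0,…⟩ : finite formal ℚ-linear combinations of words,
  -- compared through their coefficient functions.

  Poly : Set
  Poly = List (ℚ × Word)

  coeff : Poly → Word → ℚ
  coeff [] w = 0ℚ
  coeff ((c , v) ∷ p) w = if ⌊ v ≟W w ⌋ then c + coeff p w else coeff p w

  _≈_ : Poly → Poly → Set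
  p ≈ q = ∀ w → coeff p w ≡ coeff q w

  infixl 6 _⊕_
  _⊕_ : Poly → Poly → Poly
  _⊕_ = _++_

  scale : ℚ → Poly → Poly
  scale c = map (λ { (d , v) → (c * d , v) })

  word : Word → Poly
  word w = (1ℚ , w) ∷ []

  one : Poly
  one = word []

  infixl 7 _·_
  _·_ : Poly → Poly → Poly
  p · q = concatMap (λ { (c , u) → map (λ { (d , v) → (c * d , u ++ v) }) q }) p

  shw : Word → Word → List Word
  shw [] v = v ∷ []
  shw (x ∷ u) [] = (x ∷ u) ∷ []
  shw (x ∷ u) (y ∷ v) = map (x ∷_) (shw u (y ∷ v)) ++ map (y ∷_) (shw (x ∷ u) v)

  infixl 7 _⧢_
  _⧢_ : Poly → Poly → Poly
  p ⧢ q = concatMap (λ { (c , u) → concatMap (λ { (d , v) →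
            map (λ w → (c * d , w)) (shw u v) }) q }) p

  b₀ : Letter M
  b₀ = b zero

  B0 : Poly
  B0 = word (b₀ ∷ [])

  A : Poly
  A = word (a ∷ [])

  b0pow : ℕ → Poly
  b0pow zero = one
  b0pow (suc n) = B0 · b0pow n

  d : Poly → Poly
  d w = (B0 ⧢ w) ⊕ scale (- 1ℚ) (B0 · w)

  dIter : ℕ → Poly → Poly
  dIter zero w = w
  dIter (suc n) w = d (dIter n w)

  invFact : ℕ → ℚ
  invFact zero = 1ℚ
  invFact (suc n) = invFact n * (+ 1 / suc n)

  sgn : ℕ → ℚ
  sgn zero = 1ℚ
  sgn (suc n) = - sgn n

  NotEndA : Word → Set
  NotEndA [] = ⊤
  NotEndA (x ∷ []) = x ≢ a
  NotEndA (x ∷ y ∷ w) = NotEndA (y ∷ w)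

  NotStartB0 : Word → Set
  NotStartB0 [] = ⊤
  NotStartB0 (x ∷ w) = x ≢ b₀

  InA1 : Poly → Set
  InA1 p = ∀ w → coeff p w ≢ 0ℚ → NotEndA w

  InA0 : Poly → Set
  InA0 p = ∀ w → coeff p w ≢ 0ℚ → NotEndA w × NotStartB0 w

  -- 𝔄[T] : finite ℚ-combinations of  w·T^j ;  𝔄^0[T] ⊆ 𝔄[T]

  PolyT : Set
  PolyT = List (ℚ × Word × ℕ)

  coeffT : PolyT → Word → ℕ → ℚ
  coeffT [] w j = 0ℚ
  coeffT ((c , v , i) ∷ p) w j =
    if ⌊ v ≟W w ⌋ Data.Bool.∧ ⌊ i ℕ.≟ j ⌋ then c + coeffT p w j else coeffT p w j

  _≈T_ : PolyT → PolyT → Set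
  p ≈T q = ∀ w j → coeffT p w j ≡ coeffT q w j

  _⊕T_ : PolyT → PolyT → PolyT
  _⊕T_ = _++_

  scaleT : ℚ → PolyT → PolyT
  scaleT c = map (λ { (e , v , i) → (c * e , v , i) })

  embed : Poly → PolyT
  embed = map (λ { (c , v) → (c , v , 0) })

  Tvar : PolyT
  Tvar = (1ℚ , [] , 1) ∷ []

  Tpow : ℕ → PolyT
  Tpow j = (1ℚ , [] , j) ∷ []

  -- product of 𝔄^0[T] : shuffle on coefficients, T central
  _⊛_ : PolyT → PolyT → PolyT
  p ⊛ q = concatMap (λ { (c , u , i) → concatMap (λ { (e , v , j) →
            map (λ w → (c * e , w , i ℕ.+ j)) (shw u v) }) q }) p

  InA0T : PolyT → Set
  InA0T p = ∀ w j → coeffT p w j ≢ 0ℚ → NotEndA w × NotStartB0 w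

  -- reg^T_⧢ : the 𝔄^0-algebra isomorphism (𝔄^1,⧢) = 𝔄^0[b_0] → 𝔄^0[T],
  -- b_0 ↦ T.  Characterised by its (unique) defining properties.

  record IsRegT (R : Poly → PolyT) : Set where
    field
      resp    : ∀ p q → InA1 p → InA1 q → p ≈ q → R p ≈T R q
      into    : ∀ p → InA1 p → InA0T (R p)
      additive : ∀ p q → InA1 p → InA1 q → R (p ⊕ q) ≈T (R p ⊕T R q)
      homog   : ∀ c p → InA1 p → R (scale c p) ≈T scaleT c (R p)
      mult    : ∀ p q → InA1 p → InA1 q → R (p ⧢ q) ≈T (R p ⊛ R q)
      onA0    : ∀ p → InA0 p → R p ≈T embed p
      onB0    : R B0 ≈T Tvar

  -- Formal power series in u: coefficient sequences.

  SeriesA : Set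
  SeriesA = ℕ → Poly

  SeriesT : Set
  SeriesT = ℕ → PolyT

  -- (1 - b_0 u)^{-1} = Σ b_0^n u^n
  geomMinus : SeriesA
  geomMinus n = b0pow n

  -- (1 + b_0 u)^{-1} = Σ (-b_0)^n u^n
  geomPlus : SeriesA
  geomPlus n = scale (sgn n) (b0pow n)

  _·ʳ_ : SeriesA → Poly → SeriesA
  (S ·ʳ w) n = S n · w

  _ˡ·_ : Poly → SeriesA → SeriesA
  (w ˡ· S) n = w · S n

  _⧢ˢ_ : SeriesA → Poly → SeriesA
  (S ⧢ˢ w) n = S n ⧢ w

  -- exp(-du)(ω) = Σ (-u)^n d^n(ω)/n!
  expMinusD : Poly → SeriesA
  expMinusD ω n = scale (sgn n * invFact n) (dIter n ω)

  eTu : SeriesT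
  eTu n = scaleT (invFact n) (Tpow n)

  embedS : SeriesA → SeriesT
  embedS S n = embed (S n)

  regS : (Poly → PolyT) → SeriesA → SeriesT
  regS R S n = R (S n)

  _⋆_ : SeriesT → SeriesT → SeriesT
  (S ⋆ E) n = concatMap (λ k → S k ⊛ E (n ∸ k)) (upTo (suc n))

-- Write Pₙ(Y) = reg(b₀ⁿ a Y). As reg is the identity on 𝔄⁰, sends b₀ to T and is ⧢-multiplicative, the
-- shuffle identity (n + 1) b₀ⁿ⁺¹ a Y = b₀ ⧢ b₀ⁿ a Y − b₀ⁿ a (b₀ ⧢ Y) gives
--   (n + 1) Pₙ₊₁(Y) = T Pₙ(Y) − Pₙ(b₀ ⧢ Y),   P₀(Y) = a Y.
-- Since d(a Y) = a (b₀ ⧢ Y), this says (n + 1) Pₙ₊₁ = (T − d) Pₙ, so Pₙ = (T − d)ⁿ(a Y)/n!, which is the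
-- uⁿ-coefficient of exp(−du)(a Y) e^{Tu}. For the second equality, dᵏ(a Y) = a (b₀^{⧢k} ⧢ Y) = k! a (b₀ᵏ ⧢ Y).
-- Elements of 𝔄 and 𝔄[T] are lists of terms compared by coefficients, so identities between them are proved
-- by evaluating against an arbitrary linear functional on words.

module Submission where

open import Defs

open import Level using (0ℓ)
open import Data.Bool using (if_then_else_)
open import Data.Empty using (⊥-elim)
open import Data.Unit using (tt)
import Data.Integer as ℤ
open import Data.List using (List; []; _∷_; _++_; map; concatMap; filter; length; replicate; applyUpTo; upTo)
open import Data.Maybe using (Maybe; just; nothing)
open import Data.Nat as ℕ using (ℕ; zero; suc; s≤s; z≤n)
import Data.Nat.Properties as ℕ
import Data.List.Properties as ListP
open import Data.Product using (_×_; _,_; proj₁; proj₂)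
open import Data.Sum using (_⊎_; inj₁; inj₂)
open import Data.List.Relation.Unary.All using (All; []; _∷_)
import Data.List.Relation.Unary.All as All
import Data.List.Relation.Unary.All.Properties as AllP
open import Function using (id)
open import Data.Rational using (ℚ; 0ℚ; 1ℚ; _+_; _*_; -_; _-_; _/_; toℚᵘ)
open import Data.Rational.Properties
  using (+-*-commutativeRing; toℚᵘ-injective; toℚᵘ-homo-*; toℚᵘ-homo-+; toℚᵘ-fromℚᵘ;
         +-identityˡ; +-identityʳ; *-identityˡ; *-zeroʳ)
import Data.Rational.Properties as ℚ
import Data.Rational.Unnormalised as ℚᵘ
import Data.Rational.Unnormalised.Properties as ℚᵘ
import Data.Integer.Tactic.RingSolver as ℤ
open import Relation.Binary.Definitions using (DecidableEquality; tri<; tri≈; tri>)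
open import Relation.Binary.PropositionalEquality using (_≡_; _≢_; refl; sym; trans; cong; cong₂; module ≡-Reasoning)
open import Relation.Nullary using (¬_; yes; no; ¬?)
open import Relation.Unary using (Decidable)
open import Relation.Nullary.Decidable using (⌊_⌋)
open import Tactic.RingSolver using (solve-∀)
open import Algebra.Properties.Ring ℚ.+-*-ring using (-1*x≈-x)
open import Tactic.RingSolver.Core.AlmostCommutativeRing using (AlmostCommutativeRing; fromCommutativeRing)

ℚ-ring : AlmostCommutativeRing 0ℓ 0ℓ
ℚ-ring = fromCommutativeRing +-*-commutativeRing isZero
  where
  isZero : ∀ x → Maybe (0ℚ ≡ x)
  isZero x with 0ℚ ℚ.≟ x
  ... | yes e = just e
  ... | no _  = nothing

zero-term : ∀ (c x : ℚ) → c * 0ℚ + x ≡ x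
zero-term = solve-∀ ℚ-ring

fromℕ : ℕ → ℚ
fromℕ zero    = 0ℚ
fromℕ (suc n) = 1ℚ + fromℕ n

fromℕ-+ : ∀ m n → fromℕ (m ℕ.+ n) ≡ fromℕ m + fromℕ n
fromℕ-+ zero    n = sym (+-identityˡ _)
fromℕ-+ (suc m) n = trans (cong (1ℚ +_) (fromℕ-+ m n)) (sym (ℚ.+-assoc 1ℚ (fromℕ m) (fromℕ n)))

recip : ℕ → ℚ
recip n = ℤ.+ 1 / suc n

fromℕ-toℚᵘ : ∀ n → toℚᵘ (fromℕ n) ℚᵘ.≃ ℚᵘ.mkℚᵘ (ℤ.+ n) 0
fromℕ-toℚᵘ zero    = ℚᵘ.≃-refl
fromℕ-toℚᵘ (suc n) =
  ℚᵘ.≃-trans (toℚᵘ-homo-+ 1ℚ (fromℕ n))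
    (ℚᵘ.≃-trans (ℚᵘ.+-congʳ (toℚᵘ 1ℚ) (fromℕ-toℚᵘ n)) (ℚᵘ.*≡* (ℤ-identity (ℤ.+ n))))
  where
  ℤ-identity : ∀ x → (ℤ.+ 1 ℤ.* ℤ.+ 1 ℤ.+ x ℤ.* ℤ.+ 1) ℤ.* ℤ.+ 1 ≡ (ℤ.+ 1 ℤ.+ x) ℤ.* (ℤ.+ 1 ℤ.* ℤ.+ 1)
  ℤ-identity = ℤ.solve-∀

fromℕ-suc*recip : ∀ n → fromℕ (suc n) * recip n ≡ 1ℚ
fromℕ-suc*recip n = toℚᵘ-injective
  (ℚᵘ.≃-trans (toℚᵘ-homo-* (fromℕ (suc n)) (recip n))
    (ℚᵘ.≃-trans (ℚᵘ.*-cong (fromℕ-toℚᵘ (suc n)) (toℚᵘ-fromℚᵘ (ℚᵘ.mkℚᵘ (ℤ.+ 1) n)))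
      (ℚᵘ.*≡* (ℤ-identity (ℤ.+ n)))))
  where
  ℤ-identity : ∀ x → ((ℤ.+ 1 ℤ.+ x) ℤ.* ℤ.+ 1) ℤ.* ℤ.+ 1 ≡ ℤ.+ 1 ℤ.* (ℤ.+ 1 ℤ.* (ℤ.+ 1 ℤ.+ x))
  ℤ-identity = ℤ.solve-∀

δℕ : ℕ → ℕ → ℚ
δℕ j m = if ⌊ m ℕ.≟ j ⌋ then 1ℚ else 0ℚ

δℕ-suc : ∀ j m → δℕ (suc j) (suc m) ≡ δℕ j m
δℕ-suc j m with m ℕ.≟ j | suc m ℕ.≟ suc j
... | yes _    | yes _      = refl
... | no _     | no _       = refl
... | yes m≡j  | no m+1≢j+1 = ⊥-elim (m+1≢j+1 (cong suc m≡j))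
... | no m≢j   | yes m+1≡j+1 = ⊥-elim (m≢j (ℕ.suc-injective m+1≡j+1))

fact : ℕ → ℚ
fact zero    = 1ℚ
fact (suc k) = fact k * fromℕ (suc k)

invFact*fact : ∀ {M} k → invFact {M} k * fact k ≡ 1ℚ
invFact*fact zero    = refl
invFact*fact {M} (suc k) = begin
  (invFact {M} k * recip k) * (fact k * fromℕ (suc k)) ≡⟨ regroup (invFact {M} k) (recip k) (fact k) (fromℕ (suc k)) ⟩
  (invFact {M} k * fact k) * (fromℕ (suc k) * recip k) ≡⟨ cong₂ _*_ (invFact*fact {M} k) (fromℕ-suc*recip k) ⟩
  1ℚ * 1ℚ                                              ≡⟨ refl ⟩
  1ℚ ∎
  where
  open ≡-Reasoning
  regroup : ∀ (i p f n : ℚ) → (i * p) * (f * n) ≡ (i * f) * (n * p)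
  regroup = solve-∀ ℚ-ring

-- 1/(x + y) · (1/x + 1/y) = 1/(x y), phrased without division.
reciprocal-sum : ∀ {x y p q s : ℚ} → x * p ≡ 1ℚ → y * q ≡ 1ℚ → s * (x + y) ≡ 1ℚ →
                 s * (p + q) ≡ p * q
reciprocal-sum {x} {y} {p} {q} {s} xp≡1 yq≡1 s[x+y]≡1 = begin
  s * (p + q)                                    ≡⟨ times-1-1 s p q ⟩
  s * (p + q) * 1ℚ * 1ℚ                          ≡⟨ cong₂ (λ u v → s * (p + q) * u * v) (sym xp≡1) (sym yq≡1) ⟩
  s * (p + q) * (x * p) * (y * q)                ≡⟨ regroup x y p q s ⟩
  p * q * (s * ((x * p) * y + (y * q) * x))      ≡⟨ cong₂ (λ u v → p * q * (s * (u * y + v * x))) xp≡1 yq≡1 ⟩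
  p * q * (s * (1ℚ * y + 1ℚ * x))                ≡⟨ cong (λ z → p * q * (s * z)) (unit-swap x y) ⟩
  p * q * (s * (x + y))                          ≡⟨ cong (p * q *_) s[x+y]≡1 ⟩
  p * q * 1ℚ                                     ≡⟨ ℚ.*-identityʳ _ ⟩
  p * q ∎
  where
  open ≡-Reasoning
  times-1-1 : ∀ (s p q : ℚ) → s * (p + q) ≡ s * (p + q) * 1ℚ * 1ℚ
  times-1-1 = solve-∀ ℚ-ring
  regroup : ∀ (x y p q s : ℚ) → s * (p + q) * (x * p) * (y * q) ≡ p * q * (s * ((x * p) * y + (y * q) * x))
  regroup = solve-∀ ℚ-ring
  unit-swap : ∀ (x y : ℚ) → 1ℚ * y + 1ℚ * x ≡ x + y
  unit-swap = solve-∀ ℚ-ring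

recip-sum : ∀ n j → j ℕ.≤ n → recip (suc n) * (recip (n ℕ.∸ j) + recip j) ≡ recip (n ℕ.∸ j) * recip j
recip-sum n j j≤n = reciprocal-sum {fromℕ (suc (n ℕ.∸ j))} {fromℕ (suc j)} {s = recip (suc n)}
                                   (fromℕ-suc*recip (n ℕ.∸ j)) (fromℕ-suc*recip j) (begin
  recip (suc n) * (fromℕ (suc (n ℕ.∸ j)) + fromℕ (suc j))
    ≡⟨ cong (recip (suc n) *_) (sym (fromℕ-+ (suc (n ℕ.∸ j)) (suc j))) ⟩
  recip (suc n) * fromℕ (suc (n ℕ.∸ j) ℕ.+ suc j)
    ≡⟨ cong (λ m → recip (suc n) * fromℕ (suc m)) m+j+1≡n+1 ⟩
  recip (suc n) * fromℕ (suc (suc n))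
    ≡⟨ ℚ.*-comm (recip (suc n)) _ ⟩
  fromℕ (suc (suc n)) * recip (suc n)
    ≡⟨ fromℕ-suc*recip (suc n) ⟩
  1ℚ ∎)
  where
  open ≡-Reasoning
  m+j+1≡n+1 : n ℕ.∸ j ℕ.+ suc j ≡ suc n
  m+j+1≡n+1 = trans (ℕ.+-suc (n ℕ.∸ j) j) (cong suc (ℕ.m∸n+n≡m j≤n))

sumBy : {X : Set} → (X → ℚ) → List X → ℚ
sumBy h []       = 0ℚ
sumBy h (x ∷ xs) = h x + sumBy h xs

module _ {X : Set} where

  sumBy-++ : ∀ (h : X → ℚ) xs ys → sumBy h (xs ++ ys) ≡ sumBy h xs + sumBy h ys
  sumBy-++ h []       ys = sym (+-identityˡ _)
  sumBy-++ h (x ∷ xs) ys = trans (cong (h x +_) (sumBy-++ h xs ys)) (sym (ℚ.+-assoc (h x) _ _))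

  sumBy-cong : ∀ {g h : X → ℚ} → (∀ x → g x ≡ h x) → ∀ xs → sumBy g xs ≡ sumBy h xs
  sumBy-cong g≗h []       = refl
  sumBy-cong g≗h (x ∷ xs) = cong₂ _+_ (g≗h x) (sumBy-cong g≗h xs)

  sumBy-map : ∀ {Y : Set} (h : Y → ℚ) (f : X → Y) xs → sumBy h (map f xs) ≡ sumBy (λ x → h (f x)) xs
  sumBy-map h f []       = refl
  sumBy-map h f (x ∷ xs) = cong (h (f x) +_) (sumBy-map h f xs)

  sumBy-+ : ∀ (g h : X → ℚ) xs → sumBy (λ x → g x + h x) xs ≡ sumBy g xs + sumBy h xs
  sumBy-+ g h []       = sym (+-identityˡ _)
  sumBy-+ g h (x ∷ xs) = trans (cong (g x + h x +_) (sumBy-+ g h xs)) (interchange (g x) (h x) _ _)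
    where
    interchange : ∀ (x y a b : ℚ) → (x + y) + (a + b) ≡ (x + a) + (y + b)
    interchange = solve-∀ ℚ-ring

  sumBy-* : ∀ (c : ℚ) (h : X → ℚ) xs → sumBy (λ x → c * h x) xs ≡ c * sumBy h xs
  sumBy-* c h []       = sym (*-zeroʳ c)
  sumBy-* c h (x ∷ xs) = trans (cong (c * h x +_) (sumBy-* c h xs)) (sym (ℚ.*-distribˡ-+ c (h x) _))

sumBy-applyUpTo-suc : ∀ (h : ℕ → ℚ) (f : ℕ → ℕ) n →
  sumBy h (applyUpTo (λ k → suc (f k)) n) ≡ sumBy (λ k → h (suc k)) (applyUpTo f n)
sumBy-applyUpTo-suc h f zero    = refl
sumBy-applyUpTo-suc h f (suc n) = cong (h (suc (f 0)) +_) (sumBy-applyUpTo-suc h (λ k → f (suc k)) n)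

sumBy-concatMap : ∀ {X Y : Set} (h : Y → ℚ) (f : X → List Y) xs →
  sumBy h (concatMap f xs) ≡ sumBy (λ x → sumBy h (f x)) xs
sumBy-concatMap h f []       = refl
sumBy-concatMap h f (x ∷ xs) = trans (sumBy-++ h (f x) (concatMap f xs)) (cong (sumBy h (f x) +_) (sumBy-concatMap h f xs))

module FormalSum {K : Set} (_≟_ : DecidableEquality K) where

  δ : K → K → ℚ
  δ k v = if ⌊ v ≟ k ⌋ then 1ℚ else 0ℚ

  eval : (K → ℚ) → List (ℚ × K) → ℚ
  eval g = sumBy (λ cv → proj₁ cv * g (proj₂ cv))

  eval-++ : ∀ g p q → eval g (p ++ q) ≡ eval g p + eval g q
  eval-++ g = sumBy-++ _

  eval-cong : ∀ {g h} → (∀ v → g v ≡ h v) → ∀ p → eval g p ≡ eval h p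
  eval-cong g≗h = sumBy-cong (λ cv → cong (proj₁ cv *_) (g≗h (proj₂ cv)))

  eval-+ : ∀ g h p → eval (λ v → g v + h v) p ≡ eval g p + eval h p
  eval-+ g h p = trans (sumBy-cong (λ cv → ℚ.*-distribˡ-+ (proj₁ cv) _ _) p) (sumBy-+ _ _ p)

  eval-* : ∀ c g p → eval (λ v → c * g v) p ≡ c * eval g p
  eval-* c g p = trans (sumBy-cong (λ cv → swap-scalar (proj₁ cv) c _) p) (sumBy-* c _ p)
    where
    swap-scalar : ∀ (x c y : ℚ) → x * (c * y) ≡ c * (x * y)
    swap-scalar = solve-∀ ℚ-ring

  eval-map : ∀ {X : Set} g (f : X → ℚ × K) xs →
    eval g (map f xs) ≡ sumBy (λ x → proj₁ (f x) * g (proj₂ (f x))) xs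
  eval-map g f = sumBy-map _ f

  eval-concatMap : ∀ {X : Set} g (f : X → List (ℚ × K)) xs →
    eval g (concatMap f xs) ≡ sumBy (λ x → eval g (f x)) xs
  eval-concatMap g = sumBy-concatMap _

  eval-scaled : ∀ {X : Set} g (c : ℚ) (f : X → K) xs → eval g (map (λ x → (c , f x)) xs) ≡ c * sumBy (λ x → g (f x)) xs
  eval-scaled g c f xs = trans (eval-map g _ xs) (sumBy-* c _ xs)

  remove : K → List (ℚ × K) → List (ℚ × K)
  remove u []            = []
  remove u ((c , v) ∷ p) = if ⌊ v ≟ u ⌋ then remove u p else (c , v) ∷ remove u p

  eval-remove : ∀ g u p → eval g p ≡ eval (δ u) p * g u + eval g (remove u p)
  eval-remove g u [] = sym (trans (+-identityʳ _) (ℚ.*-zeroˡ (g u)))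
  eval-remove g u ((c , v) ∷ p) with v ≟ u
  ... | yes refl = trans (cong (c * g v +_) (eval-remove g v p)) (collect c (g v) _ _)
    where
    collect : ∀ (c x y a : ℚ) → c * x + (y * x + a) ≡ (c * 1ℚ + y) * x + a
    collect = solve-∀ ℚ-ring
  ... | no _ = trans (cong (c * g v +_) (eval-remove g u p)) (rearrange (c * g v) _ (g u) _ c)
    where
    rearrange : ∀ (x y z a c : ℚ) → x + (y * z + a) ≡ (c * 0ℚ + y) * z + (x + a)
    rearrange = solve-∀ ℚ-ring

  eval-zero : ∀ p → eval (λ _ → 0ℚ) p ≡ 0ℚ
  eval-zero []            = refl
  eval-zero ((c , v) ∷ p) = trans (zero-term c _) (eval-zero p)

  δ-remove-same : ∀ u p → eval (δ u) (remove u p) ≡ 0ℚ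
  δ-remove-same u [] = refl
  δ-remove-same u ((c , v) ∷ p) with v ≟ u
  ... | yes _ = δ-remove-same u p
  ... | no v≢u with v ≟ u
  ...   | yes v≡u = ⊥-elim (v≢u v≡u)
  ...   | no _    = trans (zero-term c _) (δ-remove-same u p)

  δ-remove-other : ∀ u k p → ¬ u ≡ k → eval (δ k) (remove u p) ≡ eval (δ k) p
  δ-remove-other u k [] u≢k = refl
  δ-remove-other u k ((c , v) ∷ p) u≢k with v ≟ u
  ... | no _ = cong (c * δ k v +_) (δ-remove-other u k p u≢k)
  ... | yes refl with v ≟ k
  ...   | yes v≡k = ⊥-elim (u≢k v≡k)
  ...   | no _    = trans (δ-remove-other v k p u≢k) (sym (zero-term c _))

  δ-≢ : ∀ {u k} → ¬ u ≡ k → δ k u ≡ 0ℚ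
  δ-≢ {u} {k} u≢k with u ≟ k
  ... | yes u≡k = ⊥-elim (u≢k u≡k)
  ... | no _    = refl

  length-remove : ∀ u p → length (remove u p) ℕ.≤ length p
  length-remove u [] = z≤n
  length-remove u ((c , v) ∷ p) with v ≟ u
  ... | yes _ = ℕ.m≤n⇒m≤1+n (length-remove u p)
  ... | no _  = s≤s (length-remove u p)

  eval-null : ∀ g n p → length p ℕ.≤ n → (∀ k → eval (δ k) p ≡ 0ℚ) → eval g p ≡ 0ℚ
  eval-null g n       []            _          _      = refl
  eval-null g (suc n) ((c , u) ∷ p) (s≤s |p|≤n) null = begin
    eval g ((c , u) ∷ p)
      ≡⟨ eval-remove g u ((c , u) ∷ p) ⟩
    eval (δ u) ((c , u) ∷ p) * g u + eval g (remove u ((c , u) ∷ p))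
      ≡⟨ cong₂ (λ x q → x * g u + eval g q) (null u) (remove-head u) ⟩
    0ℚ * g u + eval g (remove u p)
      ≡⟨ cong (0ℚ * g u +_) (eval-null g n (remove u p) (ℕ.≤-trans (length-remove u p) |p|≤n) null′) ⟩
    0ℚ * g u + 0ℚ
      ≡⟨ trans (+-identityʳ (0ℚ * g u)) (ℚ.*-zeroˡ (g u)) ⟩
    0ℚ ∎
    where
    open ≡-Reasoning
    remove-head : ∀ u → remove u ((c , u) ∷ p) ≡ remove u p
    remove-head u with u ≟ u
    ... | yes _   = refl
    ... | no u≢u  = ⊥-elim (u≢u refl)
    null′ : ∀ k → eval (δ k) (remove u p) ≡ 0ℚ
    null′ k with u ≟ k
    ... | yes refl = δ-remove-same u p
    ... | no u≢k   = trans (δ-remove-other u k p u≢k)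
                       (trans (sym (zero-term c _)) (trans (cong (λ x → c * x + eval (δ k) p) (sym (δ-≢ u≢k))) (null k)))

  scaleBy : ℚ → List (ℚ × K) → List (ℚ × K)
  scaleBy c = map (λ cv → (c * proj₁ cv , proj₂ cv))

  eval-scaleBy : ∀ g c p → eval g (scaleBy c p) ≡ c * eval g p
  eval-scaleBy g c p = trans (eval-map g _ p) (trans (sumBy-cong (λ cv → ℚ.*-assoc c (proj₁ cv) _) p) (sumBy-* c _ p))

  eval-resp : ∀ g {p q} → (∀ k → eval (δ k) p ≡ eval (δ k) q) → eval g p ≡ eval g q
  eval-resp g {p} {q} p≈q = begin
    eval g p
      ≡⟨ add-cancel (eval g p) (eval g q) ⟩
    (eval g p + - 1ℚ * eval g q) + eval g q
      ≡⟨ cong (_+ eval g q) (sym (eval-difference g)) ⟩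
    eval g (p ++ scaleBy (- 1ℚ) q) + eval g q
      ≡⟨ cong (_+ eval g q) (eval-null g _ (p ++ scaleBy (- 1ℚ) q) ℕ.≤-refl difference-null) ⟩
    0ℚ + eval g q
      ≡⟨ +-identityˡ _ ⟩
    eval g q ∎
    where
    open ≡-Reasoning
    eval-difference : ∀ h → eval h (p ++ scaleBy (- 1ℚ) q) ≡ eval h p + - 1ℚ * eval h q
    eval-difference h = trans (eval-++ h p _) (cong (eval h p +_) (eval-scaleBy h (- 1ℚ) q))
    add-cancel : ∀ (x y : ℚ) → x ≡ (x + - 1ℚ * y) + y
    add-cancel = solve-∀ ℚ-ring
    cancel : ∀ (y : ℚ) → y + - 1ℚ * y ≡ 0ℚ
    cancel = solve-∀ ℚ-ring
    difference-null : ∀ k → eval (δ k) (p ++ scaleBy (- 1ℚ) q) ≡ 0ℚ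
    difference-null k =
      trans (eval-difference (δ k)) (trans (cong (λ x → x + - 1ℚ * eval (δ k) q) (p≈q k)) (cancel (eval (δ k) q)))

module _ {M : ℕ} where

  open FormalSum (_≟W_ {M}) public

  Wd : Set
  Wd = Word {M}

  coeff-eval : ∀ (p : Poly {M}) w → coeff p w ≡ eval (δ w) p
  coeff-eval []            w = refl
  coeff-eval ((c , v) ∷ p) w with v ≟W w
  ... | yes _ = trans (cong (c +_) (coeff-eval p w)) (cong (_+ eval (δ w) p) (sym (ℚ.*-identityʳ c)))
  ... | no _  = trans (coeff-eval p w) (sym (zero-term c _))

  infix 4 _≐_
  record _≐_ (p q : Poly {M}) : Set where
    field eval-≡ : ∀ g → eval g p ≡ eval g q

  open _≐_ public

  ≈⇒≐ : ∀ {p q : Poly {M}} → p ≈ q → p ≐ q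
  ≈⇒≐ {p} {q} p≈q .eval-≡ g = eval-resp g {p} {q} (λ w → trans (sym (coeff-eval p w)) (trans (p≈q w) (coeff-eval q w)))

  ≐⇒≈ : ∀ {p q : Poly {M}} → p ≐ q → p ≈ q
  ≐⇒≈ {p} {q} p≐q w = trans (coeff-eval p w) (trans (p≐q .eval-≡ (δ w)) (sym (coeff-eval q w)))

  eval-· : ∀ g (p q : Poly {M}) → eval g (p · q) ≡ eval (λ u → eval (λ v → g (u ++ v)) q) p
  eval-· g p q = trans (eval-concatMap g _ p) (sumBy-cong (λ { (c , u) → row c u }) p)
    where
    row : ∀ c u → eval g (map (λ dv → (c * proj₁ dv , u ++ proj₂ dv)) q) ≡ c * eval (λ v → g (u ++ v)) q
    row c u = trans (eval-map g _ q) (trans (sumBy-cong (λ dv → ℚ.*-assoc c (proj₁ dv) _) q) (sumBy-* c _ q))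

  eval-⧢ : ∀ g (p q : Poly {M}) → eval g (p ⧢ q) ≡ eval (λ u → eval (λ v → sumBy g (shw u v)) q) p
  eval-⧢ g p q = trans (eval-concatMap g _ p) (sumBy-cong (λ { (c , u) → row c u }) p)
    where
    row : ∀ c u → eval g (concatMap (λ dv → map (λ w → (c * proj₁ dv , w)) (shw u (proj₂ dv))) q)
                  ≡ c * eval (λ v → sumBy g (shw u v)) q
    row c u = trans (eval-concatMap g _ q)
      (trans (sumBy-cong (λ dv → trans (eval-scaled g _ id (shw u (proj₂ dv))) (ℚ.*-assoc c (proj₁ dv) _)) q)
        (sumBy-* c _ q))

  eval-scale : ∀ g c (p : Poly {M}) → eval g (scale c p) ≡ c * eval g p
  eval-scale g c p = eval-scaleBy g c p

  coeff-scale : ∀ c (p : Poly {M}) w → coeff (scale c p) w ≡ c * coeff p w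
  coeff-scale c p w = trans (coeff-eval (scale c p) w) (trans (eval-scale _ c p) (cong (c *_) (sym (coeff-eval p w))))

  ·-congˡ : ∀ (p : Poly {M}) {q q′} → q ≐ q′ → p · q ≐ p · q′
  ·-congˡ p {q} {q′} q≐q′ .eval-≡ g =
    trans (eval-· g p q) (trans (eval-cong (λ u → q≐q′ .eval-≡ _) p) (sym (eval-· g p q′)))

  eval-word : ∀ g (u : Wd) → eval g (word u) ≡ g u
  eval-word g u = trans (+-identityʳ _) (*-identityˡ _)

  one·-identity : ∀ (p : Poly {M}) → one · p ≐ p
  one·-identity p .eval-≡ g = trans (eval-· g one p) (eval-word (λ u → eval (λ v → g (u ++ v)) p) [])

  eval-A· : ∀ g (p : Poly {M}) → eval g (A · p) ≡ eval (λ v → g (a ∷ v)) p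
  eval-A· g p = trans (eval-· g A p) (eval-word (λ u → eval (λ v → g (u ++ v)) p) (a ∷ []))

  eval-B0· : ∀ g (p : Poly {M}) → eval g (B0 · p) ≡ eval (λ v → g (b₀ ∷ v)) p
  eval-B0· g p = trans (eval-· g B0 p) (eval-word (λ u → eval (λ v → g (u ++ v)) p) (b₀ ∷ []))

  insertB0 : Wd → List Wd
  insertB0 = shw (b₀ ∷ [])

  eval-B0⧢ : ∀ g (p : Poly {M}) → eval g (B0 ⧢ p) ≡ eval (λ v → sumBy g (insertB0 v)) p
  eval-B0⧢ g p = trans (eval-⧢ g B0 p) (eval-word (λ u → eval (λ v → sumBy g (shw u v)) p) (b₀ ∷ []))

  b0word : ℕ → Wd
  b0word k = replicate k b₀

  eval-b0pow : ∀ g n → eval g (b0pow {M} n) ≡ g (b0word n)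
  eval-b0pow g zero    = eval-word g []
  eval-b0pow g (suc n) = trans (eval-B0· g (b0pow n)) (eval-b0pow (λ v → g (b₀ ∷ v)) n)

  eval-b0pow· : ∀ g n (p : Poly {M}) → eval g (b0pow n · p) ≡ eval (λ v → g (b0word n ++ v)) p
  eval-b0pow· g n p = trans (eval-· g (b0pow n) p) (eval-b0pow (λ u → eval (λ v → g (u ++ v)) p) n)

  eval-d : ∀ g (p : Poly {M}) → eval g (d p) ≡ eval (λ v → sumBy g (insertB0 v) - g (b₀ ∷ v)) p
  eval-d g p = begin
    eval g (d p)
      ≡⟨ eval-++ g (B0 ⧢ p) _ ⟩
    eval g (B0 ⧢ p) + eval g (scale (- 1ℚ) (B0 · p))
      ≡⟨ cong₂ _+_ (eval-B0⧢ g p) (trans (eval-scale g (- 1ℚ) (B0 · p)) (cong (- 1ℚ *_) (eval-B0· g p))) ⟩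
    eval (λ v → sumBy g (insertB0 v)) p + - 1ℚ * eval (λ v → g (b₀ ∷ v)) p
      ≡⟨ cong (eval (λ v → sumBy g (insertB0 v)) p +_) (sym (eval-* (- 1ℚ) _ p)) ⟩
    eval (λ v → sumBy g (insertB0 v)) p + eval (λ v → - 1ℚ * g (b₀ ∷ v)) p
      ≡⟨ sym (eval-+ _ _ p) ⟩
    eval (λ v → sumBy g (insertB0 v) + - 1ℚ * g (b₀ ∷ v)) p
      ≡⟨ eval-cong (λ v → cong (sumBy g (insertB0 v) +_) (-1*x≈-x (g (b₀ ∷ v)))) p ⟩
    eval (λ v → sumBy g (insertB0 v) - g (b₀ ∷ v)) p ∎
    where open ≡-Reasoning

  δ-∷ : ∀ x (v u : Wd) → δ (x ∷ v) (x ∷ u) ≡ δ v u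
  δ-∷ x v u with u ≟W v | (x ∷ u) ≟W (x ∷ v)
  ... | yes _   | yes _   = refl
  ... | no _    | no _    = refl
  ... | yes u≡v | no x∷u≢x∷v = ⊥-elim (x∷u≢x∷v (cong (x ∷_) u≡v))
  ... | no u≢v  | yes x∷u≡x∷v = ⊥-elim (u≢v (ListP.∷-injectiveʳ x∷u≡x∷v))

  coeff-A· : ∀ (p : Poly {M}) v → coeff (A · p) (a ∷ v) ≡ coeff p v
  coeff-A· p v = begin
    coeff (A · p) (a ∷ v)         ≡⟨ coeff-eval (A · p) (a ∷ v) ⟩
    eval (δ (a ∷ v)) (A · p)       ≡⟨ eval-A· _ p ⟩
    eval (λ u → δ (a ∷ v) (a ∷ u)) p ≡⟨ eval-cong (δ-∷ a v) p ⟩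
    eval (δ v) p                   ≡⟨ sym (coeff-eval p v) ⟩
    coeff p v ∎
    where open ≡-Reasoning

  sumBy-shw-cons : ∀ (g : Wd → ℚ) x u y v → sumBy g (shw (x ∷ u) (y ∷ v)) ≡
    sumBy (λ t → g (x ∷ t)) (shw u (y ∷ v)) + sumBy (λ t → g (y ∷ t)) (shw (x ∷ u) v)
  sumBy-shw-cons g x u y v =
    trans (sumBy-++ g (map (x ∷_) (shw u (y ∷ v))) _)
          (cong₂ _+_ (sumBy-map g (x ∷_) (shw u (y ∷ v))) (sumBy-map g (y ∷_) (shw (x ∷ u) v)))

  sumBy-insertB0-cons : ∀ (g : Wd → ℚ) x t →
    sumBy g (insertB0 (x ∷ t)) ≡ g (b₀ ∷ x ∷ t) + sumBy (λ z → g (x ∷ z)) (insertB0 t)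
  sumBy-insertB0-cons g x t = cong (g (b₀ ∷ x ∷ t) +_) (sumBy-map g (x ∷_) (insertB0 t))

  sumBy-insertB0-a : ∀ (g : Wd → ℚ) z →
    sumBy g (insertB0 (a ∷ z)) - g (b₀ ∷ a ∷ z) ≡ sumBy (λ t → g (a ∷ t)) (insertB0 z)
  sumBy-insertB0-a g z = trans (cong (_- g (b₀ ∷ a ∷ z)) (sumBy-insertB0-cons g a z)) (cancel (g (b₀ ∷ a ∷ z)) _)
    where
    cancel : ∀ (x y : ℚ) → (x + y) - x ≡ y
    cancel = solve-∀ ℚ-ring

  sumBy-insertB0-b0word : ∀ (g : Wd → ℚ) m → sumBy g (insertB0 (b0word m)) ≡ fromℕ (suc m) * g (b0word (suc m))
  sumBy-insertB0-b0word g zero    = one-term (g (b₀ ∷ []))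
    where
    one-term : ∀ (x : ℚ) → x + 0ℚ ≡ (1ℚ + 0ℚ) * x
    one-term = solve-∀ ℚ-ring
  sumBy-insertB0-b0word g (suc m) =
    trans (sumBy-insertB0-cons g b₀ (b0word m))
      (trans (cong (g (b0word (suc (suc m))) +_) (sumBy-insertB0-b0word (λ t → g (b₀ ∷ t)) m))
        (one-more (g (b0word (suc (suc m)))) (fromℕ (suc m))))
    where
    one-more : ∀ (x n : ℚ) → x + n * x ≡ (1ℚ + n) * x
    one-more = solve-∀ ℚ-ring

  -- b₀ ⧢ (b₀ᵏ ⧢ v) = (k + 1) b₀ᵏ⁺¹ ⧢ v, tested against an arbitrary g
  sumBy-insertB0-shw-b0word : ∀ k v (g : Wd → ℚ) →
    sumBy (λ y → sumBy g (insertB0 y)) (shw (b0word k) v) ≡ fromℕ (suc k) * sumBy g (shw (b0word (suc k)) v)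
  sumBy-insertB0-shw-b0word zero v g = one-term (sumBy g (insertB0 v))
    where
    one-term : ∀ (x : ℚ) → x + 0ℚ ≡ (1ℚ + 0ℚ) * x
    one-term = solve-∀ ℚ-ring
  sumBy-insertB0-shw-b0word (suc k) [] g =
    trans (+-identityʳ _) (trans (sumBy-insertB0-b0word g (suc k)) (cong (fromℕ (suc (suc k)) *_) (sym (+-identityʳ _))))
  sumBy-insertB0-shw-b0word (suc k) (y ∷ v) g = begin
    sumBy H (shw (b0word (suc k)) (y ∷ v))
      ≡⟨ sumBy-shw-cons H b₀ (b0word k) y v ⟩
    sumBy (λ t → H (b₀ ∷ t)) S₁ + sumBy (λ t → H (y ∷ t)) S₂
      ≡⟨ cong₂ _+_ (trans (sumBy-cong (sumBy-insertB0-cons g b₀) S₁) (sumBy-+ _ _ S₁))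
                   (trans (sumBy-cong (sumBy-insertB0-cons g y) S₂) (sumBy-+ _ _ S₂)) ⟩
    (Z₁ + sumBy (λ t → sumBy (λ z → g (b₀ ∷ z)) (insertB0 t)) S₁)
      + (Z₂ + sumBy (λ t → sumBy (λ z → g (y ∷ z)) (insertB0 t)) S₂)
      ≡⟨ cong₂ (λ p q → (Z₁ + p) + (Z₂ + q)) (sumBy-insertB0-shw-b0word k (y ∷ v) (λ z → g (b₀ ∷ z)))
                                             (sumBy-insertB0-shw-b0word (suc k) v (λ z → g (y ∷ z))) ⟩
    (Z₁ + fromℕ (suc k) * X) + (Z₂ + fromℕ (suc (suc k)) * Y)
      ≡⟨ cong (λ X′ → (Z₁ + fromℕ (suc k) * X′) + (Z₂ + fromℕ (suc (suc k)) * Y)) X≡Z₁+Z₂ ⟩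
    (Z₁ + fromℕ (suc k) * (Z₁ + Z₂)) + (Z₂ + fromℕ (suc (suc k)) * Y)
      ≡⟨ collect Z₁ Z₂ (fromℕ (suc k)) Y ⟩
    fromℕ (suc (suc k)) * ((Z₁ + Z₂) + Y)
      ≡⟨ cong (λ X′ → fromℕ (suc (suc k)) * (X′ + Y)) (sym X≡Z₁+Z₂) ⟩
    fromℕ (suc (suc k)) * (X + Y)
      ≡⟨ cong (fromℕ (suc (suc k)) *_) (sym (sumBy-shw-cons g b₀ (b0word (suc k)) y v)) ⟩
    fromℕ (suc (suc k)) * sumBy g (shw (b0word (suc (suc k))) (y ∷ v)) ∎
    where
    open ≡-Reasoning
    H : Wd → ℚ
    H t = sumBy g (insertB0 t)
    S₁ = shw (b0word k) (y ∷ v)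
    S₂ = shw (b0word (suc k)) v
    Z₁ = sumBy (λ t → g (b₀ ∷ b₀ ∷ t)) S₁
    Z₂ = sumBy (λ t → g (b₀ ∷ y ∷ t)) S₂
    X = sumBy (λ z → g (b₀ ∷ z)) (shw (b0word (suc k)) (y ∷ v))
    Y = sumBy (λ z → g (y ∷ z)) (shw (b0word (suc (suc k))) v)
    X≡Z₁+Z₂ : X ≡ Z₁ + Z₂
    X≡Z₁+Z₂ = sumBy-shw-cons (λ z → g (b₀ ∷ z)) b₀ (b0word k) y v
    collect : ∀ (z₁ z₂ n y : ℚ) → (z₁ + n * (z₁ + z₂)) + (z₂ + (1ℚ + n) * y) ≡ (1ℚ + n) * ((z₁ + z₂) + y)
    collect = solve-∀ ℚ-ring

  sumBy-insertB0-b0word-a : ∀ n (g : Wd → ℚ) v → sumBy g (insertB0 (b0word n ++ a ∷ v)) ≡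
    fromℕ (suc n) * g (b0word (suc n) ++ a ∷ v) + sumBy (λ t → g (b0word n ++ a ∷ t)) (insertB0 v)
  sumBy-insertB0-b0word-a zero g v = trans (sumBy-insertB0-cons g a v) (one-term (g (b₀ ∷ a ∷ v)) _)
    where
    one-term : ∀ (x y : ℚ) → x + y ≡ (1ℚ + 0ℚ) * x + y
    one-term = solve-∀ ℚ-ring
  sumBy-insertB0-b0word-a (suc n) g v =
    trans (sumBy-insertB0-cons g b₀ (b0word n ++ a ∷ v))
      (trans (cong (g (b0word (suc (suc n)) ++ a ∷ v) +_) (sumBy-insertB0-b0word-a n (λ t → g (b₀ ∷ t)) v))
        (one-more (g (b0word (suc (suc n)) ++ a ∷ v)) (fromℕ (suc n)) _))
    where
    one-more : ∀ (x n y : ℚ) → x + (n * x + y) ≡ (1ℚ + n) * x + y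
    one-more = solve-∀ ℚ-ring

  b0pow-suc-A· : ∀ n (p : Poly {M}) → b0pow (suc n) · (A · p) ≐
    scale (recip n) ((B0 ⧢ (b0pow n · (A · p))) ⊕ scale (- 1ℚ) (b0pow n · (A · (B0 ⧢ p))))
  b0pow-suc-A· n p .eval-≡ g = sym (begin
    eval g (scale (recip n) (B0 ⧢ Z ⊕ scale (- 1ℚ) Z′))
      ≡⟨ eval-scale g (recip n) (B0 ⧢ Z ⊕ scale (- 1ℚ) Z′) ⟩
    recip n * eval g (B0 ⧢ Z ⊕ scale (- 1ℚ) Z′)
      ≡⟨ cong (recip n *_) (eval-++ g (B0 ⧢ Z) (scale (- 1ℚ) Z′)) ⟩
    recip n * (eval g (B0 ⧢ Z) + eval g (scale (- 1ℚ) Z′))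
      ≡⟨ cong₂ (λ x y → recip n * (x + y)) eval-B0⧢Z eval-Z′ ⟩
    recip n * ((fromℕ (suc n) * E + E′) + - 1ℚ * E′)
      ≡⟨ cancel (recip n) (fromℕ (suc n)) E E′ ⟩
    (fromℕ (suc n) * recip n) * E
      ≡⟨ cong (_* E) (fromℕ-suc*recip n) ⟩
    1ℚ * E
      ≡⟨ *-identityˡ E ⟩
    E
      ≡⟨ sym (trans (eval-b0pow· g (suc n) (A · p)) (eval-A· _ p)) ⟩
    eval g (b0pow (suc n) · (A · p))                                     ∎)
    where
    open ≡-Reasoning
    Z = b0pow n · (A · p)
    Z′ = b0pow n · (A · (B0 ⧢ p))
    E = eval (λ v → g (b0word (suc n) ++ a ∷ v)) p
    E′ = eval (λ v → sumBy (λ t → g (b0word n ++ a ∷ t)) (insertB0 v)) p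
    eval-B0⧢Z : eval g (B0 ⧢ Z) ≡ fromℕ (suc n) * E + E′
    eval-B0⧢Z = begin
      eval g (B0 ⧢ Z)
        ≡⟨ eval-B0⧢ g Z ⟩
      eval (λ v → sumBy g (insertB0 v)) Z
        ≡⟨ eval-b0pow· _ n (A · p) ⟩
      eval (λ v → sumBy g (insertB0 (b0word n ++ v))) (A · p)
        ≡⟨ eval-A· _ p ⟩
      eval (λ v → sumBy g (insertB0 (b0word n ++ a ∷ v))) p
        ≡⟨ eval-cong (sumBy-insertB0-b0word-a n g) p ⟩
      eval (λ v → fromℕ (suc n) * g (b0word (suc n) ++ a ∷ v) + sumBy (λ t → g (b0word n ++ a ∷ t)) (insertB0 v)) p
                                                                               ≡⟨ eval-+ _ _ p ⟩
      eval (λ v → fromℕ (suc n) * g (b0word (suc n) ++ a ∷ v)) p + E′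
        ≡⟨ cong (_+ E′) (eval-* (fromℕ (suc n)) _ p) ⟩
      fromℕ (suc n) * E + E′ ∎
    eval-Z′ : eval g (scale (- 1ℚ) Z′) ≡ - 1ℚ * E′
    eval-Z′ = trans (eval-scale g (- 1ℚ) Z′)
      (cong (- 1ℚ *_) (trans (eval-b0pow· g n (A · (B0 ⧢ p))) (trans (eval-A· _ (B0 ⧢ p)) (eval-B0⧢ _ p))))
    cancel : ∀ (r m e e′ : ℚ) → r * ((m * e + e′) + - 1ℚ * e′) ≡ (m * r) * e
    cancel = solve-∀ ℚ-ring

  d-A· : ∀ (p : Poly {M}) → d (A · p) ≐ A · (B0 ⧢ p)
  d-A· p .eval-≡ g = begin
    eval g (d (A · p))                                                   ≡⟨ eval-d g (A · p) ⟩
    eval (λ v → sumBy g (insertB0 v) - g (b₀ ∷ v)) (A · p)               ≡⟨ eval-A· _ p ⟩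
    eval (λ v → sumBy g (insertB0 (a ∷ v)) - g (b₀ ∷ a ∷ v)) p           ≡⟨ eval-cong (sumBy-insertB0-a g) p ⟩
    eval (λ v → sumBy (λ z → g (a ∷ z)) (insertB0 v)) p                  ≡⟨ sym (eval-B0⧢ _ p) ⟩
    eval (λ v → g (a ∷ v)) (B0 ⧢ p)                                      ≡⟨ sym (eval-A· g (B0 ⧢ p)) ⟩
    eval g (A · (B0 ⧢ p)) ∎
    where open ≡-Reasoning

  dIter-cong : ∀ k {p q : Poly {M}} → p ≐ q → dIter k p ≐ dIter k q
  dIter-cong zero    p≐q = p≐q
  dIter-cong (suc k) {p} {q} p≐q .eval-≡ g =
    trans (eval-d g (dIter k p)) (trans (dIter-cong k p≐q .eval-≡ _) (sym (eval-d g (dIter k q))))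

  dIter-d : ∀ k (p : Poly {M}) → dIter k (d p) ≡ d (dIter k p)
  dIter-d zero    p = refl
  dIter-d (suc k) p = cong d (dIter-d k p)

  dIter-suc-A· : ∀ k (p : Poly {M}) → dIter (suc k) (A · p) ≐ dIter k (A · (B0 ⧢ p))
  dIter-suc-A· k p .eval-≡ g = trans (cong (eval g) (sym (dIter-d k (A · p)))) (dIter-cong k (d-A· p) .eval-≡ g)

  eval-dIter-A· : ∀ k (p : Poly {M}) g →
    eval g (dIter k (A · p)) ≡ fact k * eval (λ v → sumBy (λ z → g (a ∷ z)) (shw (b0word k) v)) p
  eval-dIter-A· zero    p g = trans (eval-A· g p) (trans (eval-cong (λ v → sym (+-identityʳ _)) p) (sym (*-identityˡ _)))
  eval-dIter-A· (suc k) p g = begin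
    eval g (d (dIter k (A · p)))
      ≡⟨ eval-d g (dIter k (A · p)) ⟩
    eval (λ v → sumBy g (insertB0 v) - g (b₀ ∷ v)) (dIter k (A · p))
      ≡⟨ eval-dIter-A· k p _ ⟩
    fact k * eval (λ v → sumBy (λ z → sumBy g (insertB0 (a ∷ z)) - g (b₀ ∷ a ∷ z)) (shw (b0word k) v)) p
      ≡⟨ cong (fact k *_) (eval-cong (λ v → sumBy-cong (sumBy-insertB0-a g) (shw (b0word k) v)) p) ⟩
    fact k * eval (λ v → sumBy (λ z → sumBy G (insertB0 z)) (shw (b0word k) v)) p
      ≡⟨ cong (fact k *_) (eval-cong (λ v → sumBy-insertB0-shw-b0word k v G) p) ⟩
    fact k * eval (λ v → fromℕ (suc k) * sumBy G (shw (b0word (suc k)) v)) p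
      ≡⟨ cong (fact k *_) (eval-* (fromℕ (suc k)) _ p) ⟩
    fact k * (fromℕ (suc k) * eval (λ v → sumBy G (shw (b0word (suc k)) v)) p)
      ≡⟨ sym (ℚ.*-assoc (fact k) _ _) ⟩
    fact (suc k) * eval (λ v → sumBy G (shw (b0word (suc k)) v)) p ∎
    where
    open ≡-Reasoning
    G : Wd → ℚ
    G z = g (a ∷ z)

  expMinusD-A· : ∀ (p : Poly {M}) k → expMinusD (A · p) k ≐ A · (geomPlus k ⧢ p)
  expMinusD-A· p k .eval-≡ g = begin
    eval g (scale (sgn {M} k * invFact {M} k) (dIter k (A · p)))
      ≡⟨ eval-scale g (sgn {M} k * invFact {M} k) (dIter k (A · p)) ⟩
    (sgn {M} k * invFact {M} k) * eval g (dIter k (A · p))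
      ≡⟨ cong ((sgn {M} k * invFact {M} k) *_) (eval-dIter-A· k p g) ⟩
    (sgn {M} k * invFact {M} k) * (fact k * E)
      ≡⟨ regroup (sgn {M} k) (invFact {M} k) (fact k) E ⟩
    sgn {M} k * (invFact {M} k * fact k) * E
      ≡⟨ cong (λ x → sgn {M} k * x * E) (invFact*fact {M} k) ⟩
    sgn {M} k * 1ℚ * E
      ≡⟨ cong (_* E) (ℚ.*-identityʳ (sgn {M} k)) ⟩
    sgn {M} k * E
      ≡⟨ cong (sgn {M} k *_) (sym (eval-b0pow H k)) ⟩
    sgn {M} k * eval H (b0pow k)
      ≡⟨ sym (eval-scale H (sgn {M} k) (b0pow k)) ⟩
    eval H (geomPlus k)
      ≡⟨ sym (eval-⧢ G (geomPlus k) p) ⟩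
    eval G (geomPlus k ⧢ p)
      ≡⟨ sym (eval-A· g (geomPlus k ⧢ p)) ⟩
    eval g (A · (geomPlus k ⧢ p)) ∎
    where
    open ≡-Reasoning
    G : Wd → ℚ
    G z = g (a ∷ z)
    H : Wd → ℚ
    H u = eval (λ v → sumBy G (shw u v)) p
    E = H (b0word k)
    regroup : ∀ (s i f e : ℚ) → (s * i) * (f * e) ≡ s * (i * f) * e
    regroup = solve-∀ ℚ-ring

  _≟ᵀ_ : DecidableEquality (Wd × ℕ)
  (v , i) ≟ᵀ (w , j) with v ≟W w | i ℕ.≟ j
  ... | yes refl | yes refl = yes refl
  ... | no v≢w   | _        = no (λ e → v≢w (cong proj₁ e))
  ... | yes _    | no i≢j   = no (λ e → i≢j (cong proj₂ e))

  module T = FormalSum _≟ᵀ_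

  coeffT-eval : ∀ (p : PolyT {M}) w j → coeffT p w j ≡ T.eval (T.δ (w , j)) p
  coeffT-eval []                w j = refl
  coeffT-eval ((c , v , i) ∷ p) w j with v ≟W w | i ℕ.≟ j
  ... | yes refl | yes refl = trans (cong (c +_) (coeffT-eval p w j)) (cong (_+ T.eval (T.δ (w , j)) p) (sym (ℚ.*-identityʳ c)))
  ... | no _     | _        = trans (coeffT-eval p w j) (sym (zero-term c _))
  ... | yes refl | no _     = trans (coeffT-eval p w j) (sym (zero-term c _))

  δᵀ : ∀ w j u m → T.δ (w , j) (u , m) ≡ δ w u * δℕ j m
  δᵀ w j u m with u ≟W w | m ℕ.≟ j
  ... | yes refl | yes refl = sym (*-identityˡ 1ℚ)
  ... | no _     | yes refl = sym (ℚ.*-zeroˡ 1ℚ)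
  ... | no _     | no _     = sym (ℚ.*-zeroˡ 0ℚ)
  ... | yes refl | no _     = sym (*-zeroʳ 1ℚ)

  eval-⊛ : ∀ g (p q : PolyT {M}) → T.eval g (p ⊛ q) ≡
    T.eval (λ x → T.eval (λ y → sumBy (λ w → g (w , proj₂ x ℕ.+ proj₂ y)) (shw (proj₁ x) (proj₁ y))) q) p
  eval-⊛ g p q = trans (T.eval-concatMap g _ p) (sumBy-cong (λ { (c , u , i) → row c u i }) p)
    where
    row : ∀ c u i → T.eval g (concatMap (λ ey → map (λ w → (c * proj₁ ey , w , i ℕ.+ proj₂ (proj₂ ey)))
                                                      (shw u (proj₁ (proj₂ ey)))) q)
                    ≡ c * T.eval (λ y → sumBy (λ w → g (w , i ℕ.+ proj₂ y)) (shw u (proj₁ y))) q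
    row c u i = trans (T.eval-concatMap g _ q)
      (trans (sumBy-cong (λ ey → trans (T.eval-scaled g _ (λ w → (w , i ℕ.+ proj₂ (proj₂ ey))) (shw u (proj₁ (proj₂ ey))))
                                       (ℚ.*-assoc c (proj₁ ey) _)) q)
        (sumBy-* c _ q))

  eval-embed : ∀ g (p : Poly {M}) → T.eval g (embed p) ≡ eval (λ u → g (u , 0)) p
  eval-embed g p = T.eval-map g _ p

  coeffT-embed : ∀ (p : Poly {M}) w j → coeffT (embed p) w j ≡ δℕ j 0 * coeff p w
  coeffT-embed p w j = begin
    coeffT (embed p) w j                      ≡⟨ coeffT-eval (embed p) w j ⟩
    T.eval (T.δ (w , j)) (embed p)             ≡⟨ eval-embed (T.δ (w , j)) p ⟩
    eval (λ u → T.δ (w , j) (u , 0)) p         ≡⟨ eval-cong (λ u → trans (δᵀ w j u 0) (ℚ.*-comm (δ w u) (δℕ j 0))) p ⟩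
    eval (λ u → δℕ j 0 * δ w u) p              ≡⟨ eval-* (δℕ j 0) (δ w) p ⟩
    δℕ j 0 * eval (δ w) p                      ≡⟨ cong (δℕ j 0 *_) (sym (coeff-eval p w)) ⟩
    δℕ j 0 * coeff p w ∎
    where open ≡-Reasoning

  coeffT-scaleT : ∀ c (p : PolyT {M}) w j → coeffT (scaleT c p) w j ≡ c * coeffT p w j
  coeffT-scaleT c p w j =
    trans (coeffT-eval (scaleT c p) w j) (trans (T.eval-scaleBy _ c p) (cong (c *_) (sym (coeffT-eval p w j))))

  coeffT-⊕T : ∀ (p q : PolyT {M}) w j → coeffT (p ⊕T q) w j ≡ coeffT p w j + coeffT q w j
  coeffT-⊕T p q w j = trans (coeffT-eval (p ⊕T q) w j)
    (trans (T.eval-++ _ p q) (sym (cong₂ _+_ (coeffT-eval p w j) (coeffT-eval q w j))))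

  ⊛-congˡ : ∀ {p p′ : PolyT {M}} → p ≈T p′ → ∀ q → (p ⊛ q) ≈T (p′ ⊛ q)
  ⊛-congˡ {p} {p′} p≈p′ q w j = begin
    coeffT (p ⊛ q) w j
      ≡⟨ coeffT-eval (p ⊛ q) w j ⟩
    T.eval (T.δ (w , j)) (p ⊛ q)
      ≡⟨ eval-⊛ _ p q ⟩
    T.eval G p
      ≡⟨ T.eval-resp G {p} {p′} (λ { (v , i) →
           trans (sym (coeffT-eval p v i)) (trans (p≈p′ v i) (coeffT-eval p′ v i)) }) ⟩
    T.eval G p′
      ≡⟨ sym (eval-⊛ _ p′ q) ⟩
    T.eval (T.δ (w , j)) (p′ ⊛ q)
      ≡⟨ sym (coeffT-eval (p′ ⊛ q) w j) ⟩
    coeffT (p′ ⊛ q) w j ∎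
    where
    open ≡-Reasoning
    G : Wd × ℕ → ℚ
    G x = T.eval (λ y → sumBy (λ w′ → T.δ (w , j) (w′ , proj₂ x ℕ.+ proj₂ y)) (shw (proj₁ x) (proj₁ y))) q

  shift : (ℕ → ℚ) → ℕ → ℚ
  shift f zero    = 0ℚ
  shift f (suc j) = f j

  shift-cong : ∀ {f g : ℕ → ℚ} → (∀ i → f i ≡ g i) → ∀ j → shift f j ≡ shift g j
  shift-cong f≗g zero    = refl
  shift-cong f≗g (suc j) = f≗g j

  coeffT-Tvar⊛ : ∀ (p : PolyT {M}) w j → coeffT (Tvar ⊛ p) w j ≡ shift (λ i → coeffT p w i) j
  coeffT-Tvar⊛ p w j = begin
    coeffT (Tvar ⊛ p) w j                 ≡⟨ coeffT-eval (Tvar ⊛ p) w j ⟩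
    T.eval (T.δ (w , j)) (Tvar ⊛ p)        ≡⟨ eval-⊛ _ Tvar p ⟩
    1ℚ * T.eval (λ y → T.δ (w , j) (proj₁ y , suc (proj₂ y)) + 0ℚ) p + 0ℚ ≡⟨ trans (+-identityʳ _) (*-identityˡ _) ⟩
    T.eval (λ y → T.δ (w , j) (proj₁ y , suc (proj₂ y)) + 0ℚ) p          ≡⟨ T.eval-cong (λ y → +-identityʳ _) p ⟩
    T.eval (λ y → T.δ (w , j) (proj₁ y , suc (proj₂ y))) p              ≡⟨ raise j ⟩
    shift (λ i → coeffT p w i) j ∎
    where
    open ≡-Reasoning
    raise : ∀ j → T.eval (λ y → T.δ (w , j) (proj₁ y , suc (proj₂ y))) p ≡ shift (λ i → coeffT p w i) j
    raise zero    = trans (T.eval-cong (λ y → trans (δᵀ w 0 (proj₁ y) (suc (proj₂ y))) (*-zeroʳ (δ w (proj₁ y)))) p)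
                          (T.eval-zero p)
    raise (suc j) = trans (T.eval-cong (λ y → trans (δᵀ w (suc j) (proj₁ y) (suc (proj₂ y)))
                            (trans (cong (δ w (proj₁ y) *_) (δℕ-suc j (proj₂ y))) (sym (δᵀ w j (proj₁ y) (proj₂ y))))) p)
                          (sym (coeffT-eval p w j))

  shw-[] : ∀ (u : Wd) → shw u [] ≡ u ∷ []
  shw-[] []      = refl
  shw-[] (x ∷ u) = refl

  coeffT-embed⊛eTu : ∀ (p : Poly {M}) m w j → coeffT (embed p ⊛ eTu m) w j ≡ invFact {M} m * δℕ j m * coeff p w
  coeffT-embed⊛eTu p m w j = begin
    coeffT (embed p ⊛ eTu m) w j
      ≡⟨ coeffT-eval (embed p ⊛ eTu m) w j ⟩
    T.eval (T.δ (w , j)) (embed p ⊛ eTu m)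
      ≡⟨ eval-⊛ (T.δ (w , j)) (embed p) (eTu m) ⟩
    T.eval (λ x → T.eval (λ y → sumBy (λ w′ → T.δ (w , j) (w′ , proj₂ x ℕ.+ proj₂ y)) (shw (proj₁ x) (proj₁ y))) (eTu m))
           (embed p)
                                                                       ≡⟨ eval-embed _ p ⟩
    eval (λ u → invFact {M} m * 1ℚ * sumBy (λ w′ → T.δ (w , j) (w′ , m)) (shw u []) + 0ℚ) p
                                                                       ≡⟨ eval-cong single p ⟩
    eval (λ u → invFact {M} m * δℕ j m * δ w u) p
      ≡⟨ eval-* (invFact {M} m * δℕ j m) (δ w) p ⟩
    invFact {M} m * δℕ j m * eval (δ w) p
      ≡⟨ cong (invFact {M} m * δℕ j m *_) (sym (coeff-eval p w)) ⟩
    invFact {M} m * δℕ j m * coeff p w ∎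
    where
    open ≡-Reasoning
    regroup : ∀ (i x y : ℚ) → i * 1ℚ * (x * y + 0ℚ) + 0ℚ ≡ i * y * x
    regroup = solve-∀ ℚ-ring
    single : ∀ u → invFact {M} m * 1ℚ * sumBy (λ w′ → T.δ (w , j) (w′ , m)) (shw u []) + 0ℚ
                 ≡ invFact {M} m * δℕ j m * δ w u
    single u rewrite shw-[] u | δᵀ w j u m = regroup (invFact {M} m) (δ w u) (δℕ j m)

  -- expCoeff n j f = f (n − j) / j! (and 0 for j > n): the coefficient of uⁿ Tʲ in (Σₖ f k uᵏ) e^{Tu}.
  expCoeff : ℕ → ℕ → (ℕ → ℚ) → ℚ
  expCoeff n       zero    f = f n
  expCoeff zero    (suc j) f = 0ℚ
  expCoeff (suc n) (suc j) f = expCoeff n j f * recip j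

  expCoeff-cong : ∀ n j {f g : ℕ → ℚ} → (∀ k → f k ≡ g k) → expCoeff n j f ≡ expCoeff n j g
  expCoeff-cong n       zero    f≗g = f≗g n
  expCoeff-cong zero    (suc j) f≗g = refl
  expCoeff-cong (suc n) (suc j) f≗g = cong (_* recip j) (expCoeff-cong n j f≗g)

  expCoeff-above : ∀ n j f → n ℕ.< j → expCoeff n j f ≡ 0ℚ
  expCoeff-above zero    (suc j) f _         = refl
  expCoeff-above (suc n) (suc j) f (s≤s n<j) = trans (cong (_* recip j) (expCoeff-above n j f n<j)) (ℚ.*-zeroˡ (recip j))

  expCoeff-unfold : ∀ n j f →
    expCoeff (suc n) j f ≡ invFact {M} (suc n) * δℕ j (suc n) * f 0 + expCoeff n j (λ k → f (suc k))
  expCoeff-unfold n zero f = sym (zero-head (invFact {M} (suc n)) (f 0) (f (suc n)))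
    where
    zero-head : ∀ (i x y : ℚ) → i * 0ℚ * x + y ≡ y
    zero-head = solve-∀ ℚ-ring
  expCoeff-unfold zero (suc zero) f = only-term (f 0) (recip 0)
    where
    only-term : ∀ (x p : ℚ) → x * p ≡ 1ℚ * p * 1ℚ * x + 0ℚ
    only-term = solve-∀ ℚ-ring
  expCoeff-unfold zero (suc (suc j)) f = no-term (f 0) (recip (suc j)) (invFact {M} 1)
    where
    no-term : ∀ (x p i : ℚ) → 0ℚ * p ≡ i * 0ℚ * x + 0ℚ
    no-term = solve-∀ ℚ-ring
  expCoeff-unfold (suc n) (suc j) f rewrite δℕ-suc j (suc n) =
    trans (cong (_* recip j) (expCoeff-unfold n j f)) (head-term j)
    where
    head-term : ∀ j → (invFact {M} (suc n) * δℕ j (suc n) * f 0 + expCoeff n j (λ k → f (suc k))) * recip j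
                    ≡ invFact {M} (suc (suc n)) * δℕ j (suc n) * f 0 + expCoeff n j (λ k → f (suc k)) * recip j
    head-term j with suc n ℕ.≟ j
    ... | yes refl = distrib (invFact {M} (suc n)) (recip (suc n)) (f 0) (expCoeff n (suc n) (λ k → f (suc k)))
      where
      distrib : ∀ (i p x y : ℚ) → (i * 1ℚ * x + y) * p ≡ i * p * 1ℚ * x + y * p
      distrib = solve-∀ ℚ-ring
    ... | no _ = distrib (invFact {M} (suc n)) (recip (suc n)) (f 0) (expCoeff n j (λ k → f (suc k))) (recip j)
      where
      distrib : ∀ (i p x y q : ℚ) → (i * 0ℚ * x + y) * q ≡ i * p * 0ℚ * x + y * q
      distrib = solve-∀ ℚ-ring

  sumBy-upTo-expCoeff : ∀ n j f →
    sumBy (λ k → invFact {M} (n ℕ.∸ k) * δℕ j (n ℕ.∸ k) * f k) (upTo (suc n)) ≡ expCoeff n j f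
  sumBy-upTo-expCoeff zero zero f = only-term (f 0)
    where
    only-term : ∀ (x : ℚ) → 1ℚ * 1ℚ * x + 0ℚ ≡ x
    only-term = solve-∀ ℚ-ring
  sumBy-upTo-expCoeff zero (suc j) f = no-term (f 0)
    where
    no-term : ∀ (x : ℚ) → 1ℚ * 0ℚ * x + 0ℚ ≡ 0ℚ
    no-term = solve-∀ ℚ-ring
  sumBy-upTo-expCoeff (suc n) j f =
    trans (cong (invFact {M} (suc n) * δℕ j (suc n) * f 0 +_)
            (trans (sumBy-applyUpTo-suc (λ k → invFact {M} (suc n ℕ.∸ k) * δℕ j (suc n ℕ.∸ k) * f k) (λ k → k) (suc n))
                   (sumBy-upTo-expCoeff n j (λ k → f (suc k)))))
      (sym (expCoeff-unfold n j f))

  coeffT-⋆eTu : ∀ (S : SeriesA {M}) n w j → coeffT ((embedS S ⋆ eTu) n) w j ≡ expCoeff n j (λ k → coeff (S k) w)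
  coeffT-⋆eTu S n w j = begin
    coeffT ((embedS S ⋆ eTu) n) w j
      ≡⟨ coeffT-eval ((embedS S ⋆ eTu) n) w j ⟩
    T.eval (T.δ (w , j)) ((embedS S ⋆ eTu) n)
      ≡⟨ T.eval-concatMap _ (λ k → embed (S k) ⊛ eTu (n ℕ.∸ k)) (upTo (suc n)) ⟩
    sumBy (λ k → T.eval (T.δ (w , j)) (embed (S k) ⊛ eTu (n ℕ.∸ k))) (upTo (suc n))
      ≡⟨ sumBy-cong (λ k → trans (sym (coeffT-eval (embed (S k) ⊛ eTu (n ℕ.∸ k)) w j))
                                 (coeffT-embed⊛eTu (S k) (n ℕ.∸ k) w j)) (upTo (suc n)) ⟩
    sumBy (λ k → invFact {M} (n ℕ.∸ k) * δℕ j (n ℕ.∸ k) * coeff (S k) w) (upTo (suc n))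
      ≡⟨ sumBy-upTo-expCoeff n j _ ⟩
    expCoeff n j (λ k → coeff (S k) w) ∎
    where open ≡-Reasoning

  ⋆eTu-cong : ∀ {S S′ : SeriesA {M}} → (∀ k → S k ≈ S′ k) → ∀ n → (embedS S ⋆ eTu) n ≈T (embedS S′ ⋆ eTu) n
  ⋆eTu-cong {S} {S′} S≈S′ n w j =
    trans (coeffT-⋆eTu S n w j) (trans (expCoeff-cong n j (λ k → S≈S′ k w)) (sym (coeffT-⋆eTu S′ n w j)))

  expMinus : (ℕ → ℚ) → ℕ → ℚ
  expMinus c m = sgn {M} m * invFact {M} m * c m

  expCoeff-expMinus-suc : ∀ n j c → j ℕ.≤ n →
    expCoeff (suc n) j (expMinus c) ≡ - recip (n ℕ.∸ j) * expCoeff n j (expMinus (λ k → c (suc k)))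
  expCoeff-expMinus-suc n zero c _ = regroup (sgn {M} n) (invFact {M} n) (recip n) (c (suc n))
    where
    regroup : ∀ (s i p x : ℚ) → - s * (i * p) * x ≡ - p * (s * i * x)
    regroup = solve-∀ ℚ-ring
  expCoeff-expMinus-suc (suc n) (suc j) c (s≤s j≤n) =
    trans (cong (_* recip j) (expCoeff-expMinus-suc n j c j≤n)) (ℚ.*-assoc (- recip (n ℕ.∸ j)) _ (recip j))

  -- T acts on coefficient sequences as shift, and d as c ↦ c ∘ suc: compare reg-b0pow-suc.
  recurrence : ℕ → ℕ → (ℕ → ℚ) → Set
  recurrence n j c = expCoeff (suc n) j (expMinus c) ≡
    recip n * (shift (λ i → expCoeff n i (expMinus c)) j - expCoeff n j (expMinus (λ k → c (suc k))))

  recurrence-zero : ∀ n c → recurrence n zero c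
  recurrence-zero n c = regroup (sgn {M} n) (invFact {M} n) (recip n) (c (suc n))
    where
    regroup : ∀ (s i p x : ℚ) → - s * (i * p) * x ≡ p * (0ℚ - s * i * x)
    regroup = solve-∀ ℚ-ring

  recurrence-below : ∀ n j c → j ℕ.≤ n → recurrence (suc n) (suc j) c
  recurrence-below n j c j≤n = begin
    expCoeff (suc n) j (expMinus c) * recip j
      ≡⟨ cong (_* recip j) (expCoeff-expMinus-suc n j c j≤n) ⟩
    - recip m * X * recip j
      ≡⟨ regroup (recip m) (recip j) X ⟩
    - X * (recip m * recip j)
      ≡⟨ cong (λ z → - X * z) (sym (recip-sum n j j≤n)) ⟩
    - X * (recip (suc n) * (recip m + recip j))
      ≡⟨ distrib (recip m) (recip j) (recip (suc n)) X ⟩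
    recip (suc n) * (- recip m * X - X * recip j)
      ≡⟨ cong (λ z → recip (suc n) * (z - X * recip j)) (sym (expCoeff-expMinus-suc n j c j≤n)) ⟩
    recip (suc n) * (expCoeff (suc n) j (expMinus c) - X * recip j) ∎
    where
    open ≡-Reasoning
    m = n ℕ.∸ j
    X = expCoeff n j (expMinus (λ k → c (suc k)))
    regroup : ∀ (p q x : ℚ) → - p * x * q ≡ - x * (p * q)
    regroup = solve-∀ ℚ-ring
    distrib : ∀ (p q s x : ℚ) → - x * (s * (p + q)) ≡ s * (- p * x - x * q)
    distrib = solve-∀ ℚ-ring

  recurrence-diagonal : ∀ n c → recurrence n (suc n) c
  recurrence-diagonal n c = begin
    expCoeff n n (expMinus c) * recip n
      ≡⟨ ℚ.*-comm _ (recip n) ⟩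
    recip n * expCoeff n n (expMinus c)
      ≡⟨ cong (recip n *_) (minus-zero _) ⟩
    recip n * (expCoeff n n (expMinus c) - 0ℚ)
      ≡⟨ cong (λ z → recip n * (expCoeff n n (expMinus c) - z)) (sym (expCoeff-above n (suc n) _ (ℕ.n<1+n n))) ⟩
    recip n * (expCoeff n n (expMinus c) - expCoeff n (suc n) (expMinus (λ k → c (suc k)))) ∎
    where
    open ≡-Reasoning
    minus-zero : ∀ (x : ℚ) → x ≡ x - 0ℚ
    minus-zero = solve-∀ ℚ-ring

  recurrence-above : ∀ n j c → n ℕ.< j → recurrence n (suc j) c
  recurrence-above n j c n<j = begin
    expCoeff n j (expMinus c) * recip j
      ≡⟨ cong (_* recip j) (expCoeff-above n j _ n<j) ⟩
    0ℚ * recip j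
      ≡⟨ all-zero (recip j) (recip n) ⟩
    recip n * (0ℚ - 0ℚ)
      ≡⟨ cong₂ (λ x y → recip n * (x - y)) (sym (expCoeff-above n j _ n<j))
                                           (sym (expCoeff-above n (suc j) _ (ℕ.m<n⇒m<1+n n<j))) ⟩
    recip n * (expCoeff n j (expMinus c) - expCoeff n (suc j) (expMinus (λ k → c (suc k)))) ∎
    where
    open ≡-Reasoning
    all-zero : ∀ (p q : ℚ) → 0ℚ * p ≡ q * (0ℚ - 0ℚ)
    all-zero = solve-∀ ℚ-ring

  expCoeff-recurrence : ∀ n j c → recurrence n j c
  expCoeff-recurrence n zero c = recurrence-zero n c
  expCoeff-recurrence n (suc j) c with ℕ.<-cmp j n
  expCoeff-recurrence (suc n) (suc j) c | tri< (s≤s j≤n) _ _ = recurrence-below n j c j≤n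
  ... | tri≈ _ refl _ = recurrence-diagonal n c
  ... | tri> _ _ n<j  = recurrence-above n j c n<j

  AllWords : (Wd → Set) → Poly {M} → Set
  AllWords P = All (λ cv → P (proj₂ cv))

  AllWords⇒nonzero : ∀ {P} {p : Poly {M}} → AllWords P p → ∀ w → coeff p w ≢ 0ℚ → P w
  AllWords⇒nonzero {p = []}            []        w coeff≢0 = ⊥-elim (coeff≢0 refl)
  AllWords⇒nonzero {p = (c , v) ∷ p} (Pv ∷ Pp) w coeff≢0 with v ≟W w
  ... | yes refl = Pv
  ... | no _     = AllWords⇒nonzero Pp w coeff≢0

  InA1-≐ : ∀ {p q : Poly {M}} → p ≐ q → InA1 q → InA1 p
  InA1-≐ p≐q q∈A¹ w coeff≢0 = q∈A¹ w (λ coeff≡0 → coeff≢0 (trans (≐⇒≈ p≐q w) coeff≡0))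

  AllWords-scale : ∀ {P} c (p : Poly {M}) → AllWords P p → AllWords P (scale c p)
  AllWords-scale c p Pp = AllP.map⁺ (All.map id Pp)

  AllWords-· : ∀ {P Q R} (p q : Poly {M}) → (∀ {u v} → P u → Q v → R (u ++ v)) →
               AllWords P p → AllWords Q q → AllWords R (p · q)
  AllWords-· []      q combine []        Qq = []
  AllWords-· (_ ∷ p) q combine (Pu ∷ Pp) Qq = AllP.++⁺ (AllP.map⁺ (All.map (combine Pu) Qq)) (AllWords-· p q combine Pp Qq)

  AllWords-⧢ : ∀ {P Q R} (p q : Poly {M}) → (∀ {u v} → P u → Q v → All R (shw u v)) →
               AllWords P p → AllWords Q q → AllWords R (p ⧢ q)
  AllWords-⧢ []      q combine []        Qq = []
  AllWords-⧢ (_ ∷ p) q combine (Pu ∷ Pp) Qq = AllP.++⁺ (inner q Qq) (AllWords-⧢ p q combine Pp Qq)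
    where
    inner : ∀ q′ → AllWords _ q′ → AllWords _ (concatMap _ q′)
    inner []       []        = []
    inner (_ ∷ q′) (Qv ∷ Qq′) = AllP.++⁺ (AllP.map⁺ (combine Pu Qv)) (inner q′ Qq′)

  AllWords-word· : ∀ {Q R} w (q : Poly {M}) → (∀ {v} → Q v → R (w ++ v)) → AllWords Q q → AllWords R (word w · q)
  AllWords-word· w q combine = AllWords-· {P = _≡ w} (word w) q (λ { refl Qv → combine Qv }) (refl ∷ [])

  AllWords-word⧢ : ∀ {Q R} w (q : Poly {M}) → (∀ {v} → Q v → All R (shw w v)) → AllWords Q q → AllWords R (word w ⧢ q)
  AllWords-word⧢ w q combine = AllWords-⧢ {P = _≡ w} (word w) q (λ { refl Qv → combine Qv }) (refl ∷ [])

  NotEndA-tail : ∀ x (u : Wd) → NotEndA (x ∷ u) → NotEndA u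
  NotEndA-tail x []      _   = tt
  NotEndA-tail x (y ∷ u) ¬ea = ¬ea

  NotEndA-∷ : ∀ x (u : Wd) → NotEndA u → u ≢ [] → NotEndA (x ∷ u)
  NotEndA-∷ x []      _   u≢[] = ⊥-elim (u≢[] refl)
  NotEndA-∷ x (y ∷ u) ¬ea _    = ¬ea

  NotEndA-++ : ∀ (u v : Wd) → NotEndA u → NotEndA v → NotEndA (u ++ v)
  NotEndA-++ []          v _   ¬ea = ¬ea
  NotEndA-++ (x ∷ [])    []      ¬ea _ = ¬ea
  NotEndA-++ (x ∷ [])    (y ∷ v) _   ¬ea = ¬ea
  NotEndA-++ (x ∷ y ∷ u) v ¬ea ¬ea′ = NotEndA-++ (y ∷ u) v ¬ea ¬ea′

  shw-NotEndA : ∀ (u v : Wd) → NotEndA u → NotEndA v → u ≢ [] ⊎ v ≢ [] →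
                All (λ w → NotEndA w × w ≢ []) (shw u v)
  shw-NotEndA []      v       _   ¬ea (inj₁ []≢[]) = ⊥-elim ([]≢[] refl)
  shw-NotEndA []      v       _   ¬ea (inj₂ v≢[])  = (¬ea , v≢[]) ∷ []
  shw-NotEndA (x ∷ u) []      ¬ea _   _            = (¬ea , λ ()) ∷ []
  shw-NotEndA (x ∷ u) (y ∷ v) ¬ea ¬ea′ _ = AllP.++⁺
    (AllP.map⁺ (All.map (λ {t} h → NotEndA-∷ x t (proj₁ h) (proj₂ h) , λ ())
      (shw-NotEndA u (y ∷ v) (NotEndA-tail x u ¬ea) ¬ea′ (inj₂ λ ()))))
    (AllP.map⁺ (All.map (λ {t} h → NotEndA-∷ y t (proj₁ h) (proj₂ h) , λ ())
      (shw-NotEndA (x ∷ u) v ¬ea (NotEndA-tail y v ¬ea′) (inj₁ λ ()))))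

  insertB0-NotEndA : ∀ (v : Wd) → NotEndA v → All (λ w → NotEndA w × w ≢ []) (insertB0 v)
  insertB0-NotEndA v ¬ea = shw-NotEndA (b₀ ∷ []) v (λ ()) ¬ea (inj₁ λ ())

  NotEndAfterA : Wd → Set
  NotEndAfterA v = NotEndA (a ∷ v)

  AllWords-B0⧢ : ∀ (p : Poly {M}) → AllWords NotEndA p → AllWords NotEndA (B0 ⧢ p)
  AllWords-B0⧢ p = AllWords-word⧢ (b₀ ∷ []) p (λ {v} ¬ea → All.map proj₁ (insertB0-NotEndA v ¬ea))

  AllWords-B0⧢-NotEndAfterA : ∀ (p : Poly {M}) → AllWords NotEndAfterA p → AllWords NotEndAfterA (B0 ⧢ p)
  AllWords-B0⧢-NotEndAfterA p = AllWords-word⧢ (b₀ ∷ []) p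
    (λ {v} ¬ea → All.map (λ {w} h → NotEndA-∷ a w (proj₁ h) (proj₂ h)) (insertB0-NotEndA v (NotEndA-tail a v ¬ea)))

  AllWords-b0pow : ∀ n → AllWords NotEndA (b0pow {M} n)
  AllWords-b0pow zero    = tt ∷ []
  AllWords-b0pow (suc n) = AllWords-word· (b₀ ∷ []) (b0pow n) (λ {v} → NotEndA-++ (b₀ ∷ []) v (λ ())) (AllWords-b0pow n)

  AllWords-A· : ∀ {P} (p : Poly {M}) → AllWords (λ v → P (a ∷ v)) p → AllWords P (A · p)
  AllWords-A· p = AllWords-word· (a ∷ []) p id

  AllWords-b0pow·A· : ∀ n (p : Poly {M}) → AllWords NotEndAfterA p → AllWords NotEndA (b0pow n · (A · p))
  AllWords-b0pow·A· n p ¬ea = AllWords-· (b0pow n) (A · p) (λ {u} {v} → NotEndA-++ u v) (AllWords-b0pow n) (AllWords-A· p ¬ea)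

  AllWords-one·A· : ∀ (p : Poly {M}) → AllWords NotEndAfterA p → AllWords (λ w → NotEndA w × NotStartB0 w) (one · (A · p))
  AllWords-one·A· p ¬ea = AllWords-word· [] (A · p) id (AllWords-A· p (All.map (λ h → h , λ ()) ¬ea))

  NotEndA? : Decidable (NotEndA {M})
  NotEndA? []          = yes tt
  NotEndA? (x ∷ [])    = ¬? (x ≟L a)
  NotEndA? (x ∷ y ∷ w) = NotEndA? (y ∷ w)

  -- a ω′ ∈ 𝔄⁰ only constrains the words of ω′ with nonzero coefficient; trimA drops the other
  -- terms, so that every listed word v of trimA ω′ has a v ∈ 𝔄¹.
  trimA : Poly {M} → Poly {M}
  trimA = filter (λ cv → NotEndA? (a ∷ proj₂ cv))

  AllWords-trimA : ∀ p → AllWords NotEndAfterA (trimA p)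
  AllWords-trimA = AllP.all-filter (λ cv → NotEndA? (a ∷ proj₂ cv))

  coeff-trimA-kept : ∀ p v → NotEndAfterA v → coeff (trimA p) v ≡ coeff p v
  coeff-trimA-kept []            v _   = refl
  coeff-trimA-kept ((c , u) ∷ p) v ¬ea with NotEndA? (a ∷ u)
  ... | yes _ with u ≟W v
  ...   | yes refl = cong (c +_) (coeff-trimA-kept p v ¬ea)
  ...   | no _     = coeff-trimA-kept p v ¬ea
  coeff-trimA-kept ((c , u) ∷ p) v ¬ea | no ea with u ≟W v
  ...   | yes refl = ⊥-elim (ea ¬ea)
  ...   | no _     = coeff-trimA-kept p v ¬ea

  coeff-trimA-dropped : ∀ p v → ¬ NotEndAfterA v → coeff (trimA p) v ≡ 0ℚ
  coeff-trimA-dropped []            v _  = refl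
  coeff-trimA-dropped ((c , u) ∷ p) v ea with NotEndA? (a ∷ u)
  ... | no _ = coeff-trimA-dropped p v ea
  ... | yes ¬ea with u ≟W v
  ...   | yes refl = ⊥-elim (ea ¬ea)
  ...   | no _     = coeff-trimA-dropped p v ea

  ≈-trimA : ∀ (p : Poly {M}) → InA0 (A · p) → p ≈ trimA p
  ≈-trimA p ap∈A⁰ v with NotEndA? (a ∷ v)
  ... | yes ¬ea = sym (coeff-trimA-kept p v ¬ea)
  ... | no ea with coeff p v ℚ.≟ 0ℚ
  ...   | yes coeff≡0 = trans coeff≡0 (sym (coeff-trimA-dropped p v ea))
  ...   | no coeff≢0  =
    ⊥-elim (ea (proj₁ (ap∈A⁰ (a ∷ v) (λ coeff≡0 → coeff≢0 (trans (sym (coeff-A· p v)) coeff≡0)))))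

  module _ (R : Poly {M} → PolyT {M}) (isReg : IsRegT R) where

    open IsRegT isReg

    dCoeffs : Poly {M} → Wd → ℕ → ℚ
    dCoeffs p w k = coeff (dIter k (A · p)) w

    reg-b0pow-zero : ∀ p → AllWords NotEndAfterA p → ∀ w j →
      coeffT (R (b0pow 0 · (A · p))) w j ≡ expCoeff 0 j (expMinus (dCoeffs p w))
    reg-b0pow-zero p ¬ea w j = begin
      coeffT (R (one · (A · p))) w j       ≡⟨ onA0 (one · (A · p)) (AllWords⇒nonzero (AllWords-one·A· p ¬ea)) w j ⟩
      coeffT (embed (one · (A · p))) w j   ≡⟨ coeffT-embed (one · (A · p)) w j ⟩
      δℕ j 0 * coeff (one · (A · p)) w     ≡⟨ cong (δℕ j 0 *_) (≐⇒≈ (one·-identity (A · p)) w) ⟩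
      δℕ j 0 * coeff (A · p) w             ≡⟨ base j ⟩
      expCoeff 0 j (expMinus (dCoeffs p w)) ∎
      where
      open ≡-Reasoning
      base : ∀ j → δℕ j 0 * coeff (A · p) w ≡ expCoeff 0 j (expMinus (dCoeffs p w))
      base zero    = cong (_* coeff (A · p) w) (sym (*-identityˡ 1ℚ))
      base (suc j) = ℚ.*-zeroˡ (coeff (A · p) w)

    reg-≐ : ∀ {p q} → InA1 p → InA1 q → p ≐ q → R p ≈T R q
    reg-≐ {p} {q} p∈A¹ q∈A¹ p≐q = resp p q p∈A¹ q∈A¹ (≐⇒≈ p≐q)

    reg-scale : ∀ c {p} → InA1 p → ∀ w j → coeffT (R (scale c p)) w j ≡ c * coeffT (R p) w j
    reg-scale c {p} p∈A¹ w j = trans (homog c p p∈A¹ w j) (coeffT-scaleT c (R p) w j)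

    reg-⊕ : ∀ {p q} → InA1 p → InA1 q → ∀ w j → coeffT (R (p ⊕ q)) w j ≡ coeffT (R p) w j + coeffT (R q) w j
    reg-⊕ {p} {q} p∈A¹ q∈A¹ w j = trans (additive p q p∈A¹ q∈A¹ w j) (coeffT-⊕T (R p) (R q) w j)

    reg-B0⧢ : ∀ {p} → InA1 p → ∀ w j → coeffT (R (B0 ⧢ p)) w j ≡ shift (λ i → coeffT (R p) w i) j
    reg-B0⧢ {p} p∈A¹ w j = begin
      coeffT (R (B0 ⧢ p)) w j          ≡⟨ mult B0 p (AllWords⇒nonzero {p = B0} ((λ ()) ∷ [])) p∈A¹ w j ⟩
      coeffT (R B0 ⊛ R p) w j          ≡⟨ ⊛-congˡ {R B0} {Tvar} onB0 (R p) w j ⟩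
      coeffT (Tvar ⊛ R p) w j          ≡⟨ coeffT-Tvar⊛ (R p) w j ⟩
      shift (λ i → coeffT (R p) w i) j ∎
      where open ≡-Reasoning

    reg-b0pow-suc : ∀ n p → AllWords NotEndAfterA p → ∀ w j →
      coeffT (R (b0pow (suc n) · (A · p))) w j ≡
        recip n * (shift (λ i → coeffT (R (b0pow n · (A · p))) w i) j - coeffT (R (b0pow n · (A · (B0 ⧢ p)))) w j)
    reg-b0pow-suc n p ¬ea w j = begin
      coeffT (R (b0pow (suc n) · (A · p))) w j
        ≡⟨ reg-≐ (AllWords⇒nonzero (AllWords-b0pow·A· (suc n) p ¬ea)) (AllWords⇒nonzero (AllWords-scale (recip n) D ¬eaD))
                 (b0pow-suc-A· n p) w j ⟩
      coeffT (R (scale (recip n) D)) w j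
        ≡⟨ reg-scale (recip n) (AllWords⇒nonzero ¬eaD) w j ⟩
      recip n * coeffT (R D) w j
        ≡⟨ cong (recip n *_) (reg-⊕ (AllWords⇒nonzero ¬eaB0⧢Z) (AllWords⇒nonzero ¬ea-Z′) w j) ⟩
      recip n * (coeffT (R (B0 ⧢ Z)) w j + coeffT (R (scale (- 1ℚ) Z′)) w j)
        ≡⟨ cong₂ (λ x y → recip n * (x + y)) (reg-B0⧢ (AllWords⇒nonzero ¬eaZ) w j)
                                             (reg-scale (- 1ℚ) (AllWords⇒nonzero ¬eaZ′) w j) ⟩
      recip n * (shift (λ i → coeffT (R Z) w i) j + - 1ℚ * coeffT (R Z′) w j)
        ≡⟨ cong (λ y → recip n * (shift (λ i → coeffT (R Z) w i) j + y)) (-1*x≈-x (coeffT (R Z′) w j)) ⟩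
      recip n * (shift (λ i → coeffT (R Z) w i) j - coeffT (R Z′) w j) ∎
      where
      open ≡-Reasoning
      Z = b0pow n · (A · p)
      Z′ = b0pow n · (A · (B0 ⧢ p))
      D = (B0 ⧢ Z) ⊕ scale (- 1ℚ) Z′
      ¬eaZ = AllWords-b0pow·A· n p ¬ea
      ¬eaZ′ = AllWords-b0pow·A· n (B0 ⧢ p) (AllWords-B0⧢-NotEndAfterA p ¬ea)
      ¬ea-Z′ = AllWords-scale (- 1ℚ) Z′ ¬eaZ′
      ¬eaB0⧢Z = AllWords-B0⧢ Z ¬eaZ
      ¬eaD : AllWords NotEndA D
      ¬eaD = AllP.++⁺ ¬eaB0⧢Z ¬ea-Z′

    reg-b0pow-A· : ∀ n p → AllWords NotEndAfterA p → ∀ w j →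
      coeffT (R (b0pow n · (A · p))) w j ≡ expCoeff n j (expMinus (dCoeffs p w))
    reg-b0pow-A· zero    p ¬ea w j = reg-b0pow-zero p ¬ea w j
    reg-b0pow-A· (suc n) p ¬ea w j = begin
      coeffT (R (b0pow (suc n) · (A · p))) w j
        ≡⟨ reg-b0pow-suc n p ¬ea w j ⟩
      recip n * (shift (λ i → coeffT (R (b0pow n · (A · p))) w i) j - coeffT (R (b0pow n · (A · (B0 ⧢ p)))) w j)
        ≡⟨ cong₂ (λ x y → recip n * (x - y)) (shift-cong (reg-b0pow-A· n p ¬ea w) j)
                 (reg-b0pow-A· n (B0 ⧢ p) (AllWords-B0⧢-NotEndAfterA p ¬ea) w j) ⟩
      recip n * (shift (λ i → expCoeff n i (expMinus (dCoeffs p w))) j - expCoeff n j (expMinus (dCoeffs (B0 ⧢ p) w)))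
        ≡⟨ cong (λ y → recip n * (shift (λ i → expCoeff n i (expMinus (dCoeffs p w))) j - y))
                (expCoeff-cong n j (λ k → cong (sgn {M} k * invFact {M} k *_) (sym (≐⇒≈ (dIter-suc-A· k p) w)))) ⟩
      recip n * (shift (λ i → expCoeff n i (expMinus (dCoeffs p w))) j - expCoeff n j (expMinus (λ k → dCoeffs p w (suc k))))
        ≡⟨ sym (expCoeff-recurrence n j (dCoeffs p w)) ⟩
      expCoeff (suc n) j (expMinus (dCoeffs p w)) ∎
      where open ≡-Reasoning

    reg-geomMinus-A· : ∀ p → InA0 (A · p) → ∀ n →
      regS R (geomMinus ·ʳ (A · p)) n ≈T (embedS (expMinusD (A · p)) ⋆ eTu) n
    reg-geomMinus-A· p ap∈A⁰ n w j = begin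
      coeffT (R (b0pow n · (A · p))) w j
        ≡⟨ reg-≐ (InA1-≐ trimmed Y∈A¹) Y∈A¹ trimmed w j ⟩
      coeffT (R (b0pow n · (A · Y))) w j
        ≡⟨ reg-b0pow-A· n Y ¬eaY w j ⟩
      expCoeff n j (expMinus (dCoeffs Y w))
        ≡⟨ expCoeff-cong n j (λ k → trans (cong (sgn {M} k * invFact {M} k *_) (sym (≐⇒≈ (dIter-cong k A·p≐A·Y) w)))
                                          (sym (coeff-scale (sgn {M} k * invFact {M} k) (dIter k (A · p)) w))) ⟩
      expCoeff n j (λ k → coeff (expMinusD (A · p) k) w)
        ≡⟨ sym (coeffT-⋆eTu (expMinusD (A · p)) n w j) ⟩
      coeffT ((embedS (expMinusD (A · p)) ⋆ eTu) n) w j ∎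
      where
      open ≡-Reasoning
      Y = trimA p
      ¬eaY = AllWords-trimA p
      Y∈A¹ = AllWords⇒nonzero (AllWords-b0pow·A· n Y ¬eaY)
      A·p≐A·Y : A · p ≐ A · Y
      A·p≐A·Y = ·-congˡ A (≈⇒≐ (≈-trimA p ap∈A⁰))
      trimmed : b0pow n · (A · p) ≐ b0pow n · (A · Y)
      trimmed = ·-congˡ (b0pow n) A·p≐A·Y

mainTheorem15 : (M : ℕ) (R : Poly {M} → PolyT {M}) → IsRegT R →
    (ω₀′ : Poly {M}) → InA0 (A · ω₀′) → (n : ℕ) →
    (regS R (geomMinus ·ʳ (A · ω₀′)) n ≈T (embedS (expMinusD (A · ω₀′)) ⋆ eTu) n)
    × ((embedS (expMinusD (A · ω₀′)) ⋆ eTu) n ≈T (embedS (A ˡ· (geomPlus ⧢ˢ ω₀′)) ⋆ eTu) n)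
mainTheorem15 M R isReg ω₀′ aω₀′∈A⁰ n =
    reg-geomMinus-A· R isReg ω₀′ aω₀′∈A⁰ n
  , ⋆eTu-cong {S = expMinusD (A · ω₀′)} {S′ = A ˡ· (geomPlus ⧢ˢ ω₀′)} (λ k → ≐⇒≈ (expMinusD-A· ω₀′ k)) n
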